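{- Let $P,Q$ be cut-free named $\mathrm{GS4}$ derivations with conclusions $\vdash\Gamma,A$ and $\vdash\Gamma,\bar A$ respectively, where all elements of $\Gamma$ are atomic formulas. Then there is a cut-free named $\mathrm{GS4}$ derivation $R$ with conclusion $\vdash\Gamma$ such that $\langle\!\langle R\rangle\!\rangle=\langle\!\langle P\rangle\!\rangle\odot_{\mathrm{names}(A)}\langle\!\langle Q\rangle\!\rangle$.
   Context: Named formulas and sequents. Fix a countably infinite set $\mathcal N$ of names and a set $\mathcal A$ of atoms with a fixpoint-free involution $\alpha\mapsto\bar\alpha$. Named formulas: $A,B::=\alpha^x\mid A\lor B\mid A\land B$ ($\alpha\in\mathcal A$, $x\in\mathcal N$); formulas $\alpha^x$ are atomic. Negation: $\overline{\alpha^x}=\bar\alpha^x$, $\overline{A\lor B}=\bar A\land\bar B$, $\overline{A\land B}=\bar A\lor\bar B$ (names preserved). $\mathrm{names}(A)$ is the set of names in $A$, $\mathrm{names}(\Gamma)=\bigcup_{A\in\Gamma}\mathrm{names}(A)$. $A\equiv B$ means $A,B$ coincide after erasing names. A formula is sharing-free if each name occurs in it at most once; a set is sharing-free if its members are sharing-free with pairwise disjoint name sets. A sequent $\vdash\Gamma$ is a finite sharing-free set $\Gamma$; in comma notation the components have pairwise disjoint name sets and $\Gamma,A=\Gamma\cup\{A\}$. Derivations. Named $\mathrm{GS4}$ derivations are finite trees of rule applications labelled with sharing-free sequents: axiom $\mathrm{ax}_{\{A,\bar B\}}$ (no premisses, conclusion $\vdash\Gamma,A,\bar B$, $A\equiv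 B$); cut (premisses $\vdash\Gamma,A$, $\vdash\Gamma,\bar A$, conclusion $\vdash\Gamma$); superposition $\sqcup$ (premisses $\vdash\Gamma$, $\vdash\Gamma$, conclusion $\vdash\Gamma$); $\lor$ (premiss $\vdash\Gamma,A,B$, conclusion $\vdash\Gamma,A\lor B$); $\land$ (premisses $\vdash\Gamma,A$, $\vdash\Gamma,B$, conclusion $\vdash\Gamma,A\land B$). Cut-free: no cut rule occurs. Branches. $\mathrm{Br}(\alpha^x)=\{\{x\}\}$, $\mathrm{Br}(B\lor C)=\{X\cup Y\mid X\in\mathrm{Br}(B),Y\in\mathrm{Br}(C)\}$, $\mathrm{Br}(B\land C)=\mathrm{Br}(B)\cup\mathrm{Br}(C)$; for sharing-free $\Gamma$, $\mathrm{Br}(\Gamma)=\{X\subseteq\mathrm{names}(\Gamma)\mid\forall A\in\Gamma,\ X\cap\mathrm{names}(A)\in\mathrm{Br}(A)\}$. Branch-labeled graphs. A bl-graph is $G=\langle V_G,\triangleleft_G\rangle$ with $V_G\subseteq\mathcal N$ and $\triangleleft_G$ a relation between 2-element subsets $e$ of $V_G$ and subsets $X\subseteq V_G$ such that $e\triangleleft_G X$ implies $e\subseteq X$. Union $\sqcup$ is componentwise union; equality is equality of both components. For $I\subseteq\mathcal N$: $e\triangleleft^I_G X$ iff $e\triangleleft_G Y$ for some $Y$ with $X=Y\setminus I$. An alternating $X$-labeled path between bl-graphs $G,H$ through $I$ is a sequence $x_1,\dots,x_n$ ($n>1$) of pairwise distinct vertices of $G$ or $H$ with $x_i\in I$ for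 $1<i<n$ such that either $x_ix_{i+1}\triangleleft^I_G X$ for all odd $i$ and $x_ix_{i+1}\triangleleft^I_H X$ for all even $i$, or the same with $G,H$ swapped; it is complete if $x_1,x_n\notin I$. $G\odot_I H$ has vertex set $V=(V_G\cup V_H)\setminus I$ and, for $x\ne y\in V$, $X\subseteq V$, $xy\triangleleft X$ iff there is a complete alternating $X$-labeled path from $x$ to $y$ between $G$ and $H$ through $I$. $\mathrm{wk}_\Gamma(G)=\langle V_G\cup\mathrm{names}(\Gamma),\{(e,X\cup Y)\mid e\triangleleft_G X,\,Y\in\mathrm{Br}(\Gamma)\}\rangle$. $\mathrm{id}_{\{\alpha^x,\bar\alpha^y\}}=\langle\{x,y\},\{(xy,\{x,y\})\}\rangle$, and for disjoint sharing-free $A_1\lor A_2$, $\bar B_1\land\bar B_2$ with $A_i\equiv B_i$, $\mathrm{id}_{\{A_1\lor A_2,\bar B_1\land\bar B_2\}}=\mathrm{wk}_{\{A_2\}}(\mathrm{id}_{\{A_1,\bar B_1\}})\sqcup\mathrm{wk}_{\{A_1\}}(\mathrm{id}_{\{A_2,\bar B_2\}})$ (every axiom pair of non-atomic formulas is an unordered pair of this shape). $\langle\!\langle P\rangle\!\rangle$ is $\mathrm{wk}_\Gamma(\mathrm{id}_{\{A,\bar B\}})$ for an axiom $\mathrm{ax}_{\{A,\bar B\}}$ with conclusion $\vdash\Gamma,A,\bar B$; $\langle\!\langle Q\rangle\!\rangle\odot_{\mathrm{names}(A)}\langle\!\langle R\rangle\!\rangle$ for a cut with premiss derivations $Q$ of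 $\vdash\Gamma,A$, $R$ of $\vdash\Gamma,\bar A$; the union of the premisses' bl-graphs for $\sqcup,\lor,\land$. -}

module Defs where

open import Level using (Lift; 0ℓ) renaming (suc to lsuc)

L1 : Set → Set₁
L1 = Lift (lsuc 0ℓ)
open import Data.Nat using (ℕ)
open import Data.Empty using (⊥)
open import Data.Unit using (⊤)
open import Data.Product using (Σ; _×_; _,_)
open import Data.Sum using (_⊎_)
open import Data.List using (List; []; _∷_; _++_)
open import Data.List.Relation.Unary.All using (All)
open import Data.List.Relation.Unary.AllPairs using (AllPairs)
open import Data.List.Relation.Unary.Unique.Propositional using (Unique)
open import Data.List.Relation.Binary.Permutation.Propositional using (_↭_)
open import Relation.Binary.PropositionalEquality using (_≡_; _≢_)
open import Relation.Nullary using (¬_)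

Subset : Set₁
Subset = ℕ → Set

_≐_ : Subset → Subset → Set
X ≐ Y = ∀ z → (X z → Y z) × (Y z → X z)

_⊆_ : Subset → Subset → Set
X ⊆ Y = ∀ z → X z → Y z

_∪_ : Subset → Subset → Subset
(X ∪ Y) z = X z ⊎ Y z

_∩_ : Subset → Subset → Subset
(X ∩ Y) z = X z × Y z

_∖_ : Subset → Subset → Subset
(X ∖ Y) z = X z × ¬ Y z

∅ : Subset
∅ _ = ⊥

⟦_⟧ : ℕ → Subset
⟦ x ⟧ z = z ≡ x

⟦_،_⟧ : ℕ → ℕ → Subset
⟦ x ، y ⟧ z = (z ≡ x) ⊎ (z ≡ y)

Disjoint : Subset → Subset → Set
Disjoint X Y = ∀ z → X z → Y z → ⊥

-- Branch-labeled graphs.  E a b X means  {a,b} ◁ X.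
-- Edges are unordered pairs: equality of bl-graphs (_≈G_) compares
-- E a b with E a b or E b a, and labels X up to extensional equality.

record BLG : Set₂ where
  field
    V : Subset
    E : ℕ → ℕ → Subset → Set₁
open BLG public

_⊔_ : BLG → BLG → BLG
G ⊔ H = record { V = V G ∪ V H ; E = λ a b X → E G a b X ⊎ E H a b X }

emptyG : BLG
emptyG = record { V = ∅ ; E = λ _ _ _ → L1 ⊥ }

record _≈G_ (G H : BLG) : Set₁ where
  field
    V≐ : V G ≐ V H
    E⊆ : ∀ a b X → E G a b X →
           Σ Subset λ X' → X ≐ X' × (E H a b X' ⊎ E H b a X')
    E⊇ : ∀ a b X → E H a b X →
           Σ Subset λ X' → X ≐ X' × (E G a b X' ⊎ E G b a X')

Ed : BLG → ℕ → ℕ → Subset → Set₁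
Ed G x y X = E G x y X ⊎ E G y x X

EdI : BLG → Subset → ℕ → ℕ → Subset → Set₁
EdI G I x y X = Σ Subset λ Y → Ed G x y Y × (X ≐ (Y ∖ I))

Alt : BLG → BLG → Subset → Subset → List ℕ → Set₁
Alt G H I X [] = L1 ⊤
Alt G H I X (x ∷ []) = L1 ⊤
Alt G H I X (x ∷ y ∷ r) = EdI G I x y X × Alt H G I X (y ∷ r)

CompletePath : BLG → BLG → Subset → Subset → ℕ → ℕ → Set₁
CompletePath G H I X x y =
  Σ (List ℕ) λ mids →
    let xs = x ∷ (mids ++ (y ∷ [])) in
    Unique xs
    × All (λ v → V G v ⊎ V H v) xs
    × All I mids
    × ¬ I x × ¬ I y
    × (Alt G H I X xs ⊎ Alt H G I X xs)

_⊙[_]_ : BLG → Subset → BLG → BLG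
G ⊙[ I ] H = record
  { V = Vp
  ; E = λ x y X → (x ≢ y) × Vp x × Vp y × (X ⊆ Vp) × CompletePath G H I X x y
  }
  where
  Vp : Subset
  Vp v = (V G v ⊎ V H v) × ¬ I v

module WithAtoms (At : Set) (bar : At → At) where

  infixr 6 _∨_ _∧_
  data Fm : Set where
    atom : At → ℕ → Fm
    _∨_  : Fm → Fm → Fm
    _∧_  : Fm → Fm → Fm

  neg : Fm → Fm
  neg (atom a x) = atom (bar a) x
  neg (A ∨ B) = neg A ∧ neg B
  neg (A ∧ B) = neg A ∨ neg B

  names : Fm → Subset
  names (atom a x) = ⟦ x ⟧
  names (A ∨ B) = names A ∪ names B
  names (A ∧ B) = names A ∪ names B

  namesL : List Fm → Subset
  namesL [] = ∅
  namesL (A ∷ Γ) = names A ∪ namesL Γ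

  -- formulas with names erased;  A ≡ B  in the paper is  erase A ≡ erase B
  data UFm : Set where
    uatom : At → UFm
    _u∨_  : UFm → UFm → UFm
    _u∧_  : UFm → UFm → UFm

  erase : Fm → UFm
  erase (atom a x) = uatom a
  erase (A ∨ B) = erase A u∨ erase B
  erase (A ∧ B) = erase A u∧ erase B

  IsAtomic : Fm → Set
  IsAtomic (atom a x) = ⊤
  IsAtomic (A ∨ B) = ⊥
  IsAtomic (A ∧ B) = ⊥

  SharingFree : Fm → Set
  SharingFree (atom a x) = ⊤
  SharingFree (A ∨ B) = SharingFree A × SharingFree B × Disjoint (names A) (names B)
  SharingFree (A ∧ B) = SharingFree A × SharingFree B × Disjoint (names A) (names B)

  -- a sequent (finite sharing-free set), listed in some order
  WF : List Fm → Set
  WF Γ = All SharingFree Γ × AllPairs (λ A B → Disjoint (names A) (names B)) Γ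

  -- Named GS4 derivations.  The conclusion Δ is any listing of the set
  -- displayed in the rule (Δ ↭ …); every conclusion is sharing-free.
  data Deriv : List Fm → Set where
    ax  : ∀ {Δ} (Γ : List Fm) (A B : Fm) → erase A ≡ erase B →
          WF Δ → Δ ↭ (A ∷ neg B ∷ Γ) → Deriv Δ
    cut : ∀ {Δ} (Γ : List Fm) (A : Fm) → Deriv (A ∷ Γ) → Deriv (neg A ∷ Γ) →
          WF Δ → Δ ↭ Γ → Deriv Δ
    sup : ∀ {Δ} (Γ : List Fm) → Deriv Γ → Deriv Γ →
          WF Δ → Δ ↭ Γ → Deriv Δ
    or  : ∀ {Δ} (Γ : List Fm) (A B : Fm) → Deriv (A ∷ B ∷ Γ) →
          WF Δ → Δ ↭ ((A ∨ B) ∷ Γ) → Deriv Δ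
    and : ∀ {Δ} (Γ : List Fm) (A B : Fm) → Deriv (A ∷ Γ) → Deriv (B ∷ Γ) →
          WF Δ → Δ ↭ ((A ∧ B) ∷ Γ) → Deriv Δ

  CutFree : ∀ {Δ} → Deriv Δ → Set
  CutFree (ax _ _ _ _ _ _) = ⊤
  CutFree (cut _ _ _ _ _ _) = ⊥
  CutFree (sup _ P Q _ _) = CutFree P × CutFree Q
  CutFree (or _ _ _ P _ _) = CutFree P
  CutFree (and _ _ _ P Q _ _) = CutFree P × CutFree Q

  Br : Fm → Subset → Set₁
  Br (atom a x) X = L1 (X ≐ ⟦ x ⟧)
  Br (B ∨ C) X = Σ Subset λ Y → Σ Subset λ Z → Br B Y × Br C Z × L1 (X ≐ (Y ∪ Z))
  Br (B ∧ C) X = Br B X ⊎ Br C X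

  BrL : List Fm → Subset → Set₁
  BrL Γ X = L1 (X ⊆ namesL Γ) × All (λ A → Br A (X ∩ names A)) Γ

  wk : List Fm → BLG → BLG
  wk Γ G = record
    { V = V G ∪ namesL Γ
    ; E = λ a b Z → Σ Subset λ X → Σ Subset λ Y →
            E G a b X × BrL Γ Y × L1 (Z ≐ (X ∪ Y))
    }

  idg : Fm → Fm → BLG
  idg (atom a x) (atom b y) = record
    { V = ⟦ x ، y ⟧
    ; E = λ u v X → L1 (((u ≡ x) × (v ≡ y)) ⊎ ((u ≡ y) × (v ≡ x)))
                    × L1 (X ≐ ⟦ x ، y ⟧)
    }
  idg (A₁ ∨ A₂) (C₁ ∧ C₂) = wk (A₂ ∷ []) (idg A₁ C₁) ⊔ wk (A₁ ∷ []) (idg A₂ C₂)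
  idg (A₁ ∧ A₂) (C₁ ∨ C₂) = wk (C₂ ∷ []) (idg C₁ A₁) ⊔ wk (C₁ ∷ []) (idg C₂ A₂)
  idg _ _ = emptyG

  ⟪_⟫ : ∀ {Δ} → Deriv Δ → BLG
  ⟪ ax Γ A B _ _ _ ⟫ = wk Γ (idg A (neg B))
  ⟪ cut Γ A P Q _ _ ⟫ = ⟪ P ⟫ ⊙[ names A ] ⟪ Q ⟫
  ⟪ sup _ P Q _ _ ⟫ = ⟪ P ⟫ ⊔ ⟪ Q ⟫
  ⟪ or _ _ _ P _ _ ⟫ = ⟪ P ⟫
  ⟪ and _ _ _ P Q _ _ ⟫ = ⟪ P ⟫ ⊔ ⟪ Q ⟫

module Submission where

-- The graph of a cut-free derivation of ⊢ Δ is Correct for Δ: its vertices are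
-- the names of Δ, each edge joins dual atom occurrences and has a label
-- containing the names of the atomic members of Δ, and every branch of Δ
-- contains both ends of some edge.  Each rule preserves this, and identity
-- graphs are assembled from atomic ones by the same ∨, ∧ and weakening steps.
--
-- For a cut against an atomic Γ the labels of G ⊙ H are all names Γ, and an
-- edge xy (a link) is a complete alternating path, along which the atom is carried
-- from αˣ to ᾱʸ in Γ; so it is the graph of the axiom on αˣ, ᾱʸ, and R is the
-- superposition of these axioms.  Links are decidable, a path running through
-- distinct names of A, and one exists: otherwise colour each name of A by
-- whether a walk from Γ reaches it with a last step in G (in H, or neither,
-- breaking ties by a colouring separating dual atoms); some branch of A, or
-- of Ā, is monochromatic, and the edge of G, resp. H, that correctness puts
-- on it together with Γ either closes a walk from Γ to Γ or contradicts the
-- colouring.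

open import Defs
open import Level using (lift)
open import Data.Bool using (Bool; true; false; not)
open import Data.Empty using (⊥; ⊥-elim)
open import Data.Unit using (tt)
open import Data.Nat using (ℕ; zero; suc; _≤_; z≤n; s≤s; _≟_)
open import Data.Product using (Σ; _×_; _,_; proj₁; proj₂)
open import Data.Sum using (_⊎_; inj₁; inj₂; [_,_]′; map₁; map₂; reduce)
open import Data.List using (List; []; _∷_; _++_; length; map; concatMap; cartesianProduct; filter)
open import Data.List.Properties using (length-++-sucʳ)
open import Data.List.Relation.Unary.All using (All; []; _∷_)
import Data.List.Relation.Unary.All as All
import Data.List.Relation.Unary.All.Properties as Allₚ
open import Data.List.Relation.Unary.All.Properties using (¬Any⇒All¬; All¬⇒¬Any)
open import Data.List.Relation.Unary.Any using (Any; here; there)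
import Data.List.Relation.Unary.Any as Any
import Data.List.Relation.Unary.Any.Properties as Anyₚ
open import Data.List.Relation.Unary.AllPairs using (AllPairs; []; _∷_)
import Data.List.Relation.Unary.AllPairs as AllPairs
open import Data.List.Relation.Unary.Unique.Propositional using (Unique)
import Data.List.Relation.Unary.Unique.Propositional.Properties as Uniqueₚ
open import Data.List.Relation.Unary.Unique.DecPropositional _≟_ using (unique?)
open import Data.List.Membership.Propositional using (_∈_; _∉_; lose)
open import Data.List.Membership.Propositional.Properties
  using (∈-∃++; ∈-map⁺; ∈-concatMap⁺; ∈-cartesianProduct⁺; ∈-filter⁺)
open import Data.List.Membership.DecPropositional _≟_ using (_∈?_)
open import Data.List.Relation.Binary.Permutation.Propositional
  using (_↭_; prep; swap; ↭-sym) renaming (refl to ↭-refl; trans to ↭-trans)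
open import Data.List.Relation.Binary.Permutation.Propositional.Properties
  using (Any-resp-↭; All-resp-↭; shift)
open import Function using (case_of_)
open import Relation.Binary.PropositionalEquality using (_≡_; _≢_; refl; sym; trans; cong; subst)
open import Relation.Nullary using (¬_; Dec; yes; no)
open import Relation.Nullary.Decidable using (map′; _×-dec_; _⊎-dec_; ¬?; ¬¬-excluded-middle)

module CutAgainstAtomicContext
  (At : Set) (bar : At → At)
  (bar-involutive : ∀ a → bar (bar a) ≡ a) (bar-irreflexive : ∀ a → bar a ≢ a) where

  open WithAtoms At bar

  ≐-refl : ∀ {X} → X ≐ X
  ≐-refl z = (λ p → p) , (λ p → p)

  ≐-sym : ∀ {X Y} → X ≐ Y → Y ≐ X
  ≐-sym e z = proj₂ (e z) , proj₁ (e z)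

  ≐-trans : ∀ {X Y Z} → X ≐ Y → Y ≐ Z → X ≐ Z
  ≐-trans e f z = (λ p → proj₁ (f z) (proj₁ (e z) p)) , (λ p → proj₂ (e z) (proj₂ (f z) p))

  to : ∀ {X Y} → X ≐ Y → ∀ {z} → X z → Y z
  to e {z} = proj₁ (e z)

  from : ∀ {X Y} → X ≐ Y → ∀ {z} → Y z → X z
  from e {z} = proj₂ (e z)

  ∪-cong : ∀ {X X′ Y Y′} → X ≐ X′ → Y ≐ Y′ → (X ∪ Y) ≐ (X′ ∪ Y′)
  ∪-cong e f z =
    (λ { (inj₁ p) → inj₁ (to e p) ; (inj₂ p) → inj₂ (to f p) }) ,
    (λ { (inj₁ p) → inj₁ (from e p) ; (inj₂ p) → inj₂ (from f p) })

  ∪-assoc : ∀ X Y Z → ((X ∪ Y) ∪ Z) ≐ (X ∪ (Y ∪ Z))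
  ∪-assoc X Y Z z =
    (λ { (inj₁ (inj₁ p)) → inj₁ p ; (inj₁ (inj₂ p)) → inj₂ (inj₁ p) ; (inj₂ p) → inj₂ (inj₂ p) }) ,
    (λ { (inj₁ p) → inj₁ (inj₁ p) ; (inj₂ (inj₁ p)) → inj₁ (inj₂ p) ; (inj₂ (inj₂ p)) → inj₂ p })

  ∈⇒↭∷ : ∀ {B : Set} {x : B} {xs} → x ∈ xs → Σ (List B) λ ys → xs ↭ x ∷ ys
  ∈⇒↭∷ {x = x} m with ∈-∃++ m
  ... | ys , zs , refl = ys ++ zs , shift x ys zs

  Unique-++⁻ˡ : ∀ {B : Set} (l : List B) {r} → Unique (l ++ r) → Unique l
  Unique-++⁻ˡ [] _ = []
  Unique-++⁻ˡ (_ ∷ l) (a ∷ u) = Allₚ.++⁻ˡ l a ∷ Unique-++⁻ˡ l u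

  Unique-++⁻ʳ : ∀ {B : Set} (l : List B) {r} → Unique (l ++ r) → Unique r
  Unique-++⁻ʳ [] u = u
  Unique-++⁻ʳ (_ ∷ l) (_ ∷ u) = Unique-++⁻ʳ l u

  ∈-remove : ∀ {B : Set} {v m : B} l {r} → v ∈ l ++ m ∷ r → v ≢ m → v ∈ l ++ r
  ∈-remove [] (here e) v≢m = ⊥-elim (v≢m e)
  ∈-remove [] (there p) _ = p
  ∈-remove (_ ∷ l) (here e) _ = here e
  ∈-remove (_ ∷ l) (there p) v≢m = there (∈-remove l p v≢m)

  length-Unique-⊆ : ∀ {B : Set} {ms vs : List B} → Unique ms → All (_∈ vs) ms → length ms ≤ length vs
  length-Unique-⊆ {ms = []} _ _ = z≤n
  length-Unique-⊆ {ms = m ∷ ms} (m∉ ∷ u) (m∈ ∷ ms⊆) with ∈-∃++ m∈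
  ... | l , r , refl rewrite length-++-sucʳ l m r =
    s≤s (length-Unique-⊆ u (All.zipWith (λ (m≢ , p) → ∈-remove l p (λ e → m≢ (sym e))) (m∉ , ms⊆)))

  lists≤ : ∀ {B : Set} → ℕ → List B → List (List B)
  lists≤ zero vs = [] ∷ []
  lists≤ (suc k) vs = [] ∷ concatMap (λ v → map (v ∷_) (lists≤ k vs)) vs

  ∈-lists≤ : ∀ {B : Set} k (vs : List B) {ms} → All (_∈ vs) ms → length ms ≤ k → ms ∈ lists≤ k vs
  ∈-lists≤ zero vs [] _ = here refl
  ∈-lists≤ (suc k) vs [] _ = here refl
  ∈-lists≤ (suc k) vs (m∈ ∷ ms⊆) (s≤s ≤k) =
    there (∈-concatMap⁺ (λ v → map (v ∷_) (lists≤ k vs))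
                        (Any.map (λ { refl → ∈-map⁺ (_ ∷_) (∈-lists≤ k vs ms⊆ ≤k) }) m∈))

  names? : ∀ A z → Dec (names A z)
  names? (atom a x) z = z ≟ x
  names? (A ∨ B) z = names? A z ⊎-dec names? B z
  names? (A ∧ B) z = names? A z ⊎-dec names? B z

  namesL? : ∀ Γ z → Dec (namesL Γ z)
  namesL? [] z = no λ ()
  namesL? (A ∷ Γ) z = names? A z ⊎-dec namesL? Γ z

  nameList : Fm → List ℕ
  nameList (atom a x) = x ∷ []
  nameList (A ∨ B) = nameList A ++ nameList B
  nameList (A ∧ B) = nameList A ++ nameList B

  nameListL : List Fm → List ℕ
  nameListL [] = []
  nameListL (A ∷ Γ) = nameList A ++ nameListL Γ

  ∈-nameList : ∀ A {z} → names A z → z ∈ nameList A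
  ∈-nameList (atom a x) refl = here refl
  ∈-nameList (A ∨ B) (inj₁ p) = Anyₚ.++⁺ˡ (∈-nameList A p)
  ∈-nameList (A ∨ B) (inj₂ p) = Anyₚ.++⁺ʳ (nameList A) (∈-nameList B p)
  ∈-nameList (A ∧ B) (inj₁ p) = Anyₚ.++⁺ˡ (∈-nameList A p)
  ∈-nameList (A ∧ B) (inj₂ p) = Anyₚ.++⁺ʳ (nameList A) (∈-nameList B p)

  ∈-nameListL : ∀ Γ {z} → namesL Γ z → z ∈ nameListL Γ
  ∈-nameListL (A ∷ Γ) (inj₁ p) = Anyₚ.++⁺ˡ (∈-nameList A p)
  ∈-nameListL (A ∷ Γ) (inj₂ p) = Anyₚ.++⁺ʳ (nameList A) (∈-nameListL Γ p)

  namesL⇒Any : ∀ Γ {z} → namesL Γ z → Any (λ A → names A z) Γ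
  namesL⇒Any (A ∷ Γ) (inj₁ p) = here p
  namesL⇒Any (A ∷ Γ) (inj₂ p) = there (namesL⇒Any Γ p)

  Any⇒namesL : ∀ {Γ z} → Any (λ A → names A z) Γ → namesL Γ z
  Any⇒namesL (here p) = inj₁ p
  Any⇒namesL (there p) = inj₂ (Any⇒namesL p)

  namesL-resp-↭ : ∀ {Γ Δ} → Γ ↭ Δ → namesL Γ ≐ namesL Δ
  namesL-resp-↭ {Γ} {Δ} p z =
    (λ q → Any⇒namesL (Any-resp-↭ p (namesL⇒Any Γ q))) ,
    (λ q → Any⇒namesL (Any-resp-↭ (↭-sym p) (namesL⇒Any Δ q)))

  namesL-++ : ∀ Δ {Γ} → namesL (Δ ++ Γ) ≐ (namesL Δ ∪ namesL Γ)
  namesL-++ [] z = inj₂ , λ { (inj₂ p) → p }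
  namesL-++ (A ∷ Δ) {Γ} = ≐-trans (∪-cong ≐-refl (namesL-++ Δ)) (≐-sym (∪-assoc (names A) (namesL Δ) (namesL Γ)))

  names-neg : ∀ A → names (neg A) ≐ names A
  names-neg (atom a x) = ≐-refl
  names-neg (A ∨ B) = ∪-cong (names-neg A) (names-neg B)
  names-neg (A ∧ B) = ∪-cong (names-neg A) (names-neg B)

  Disjoint-namesL : ∀ A {Γ z} → All (λ B → Disjoint (names A) (names B)) Γ → names A z → namesL Γ z → ⊥
  Disjoint-namesL A (d ∷ ds) p (inj₁ q) = d _ p q
  Disjoint-namesL A (d ∷ ds) p (inj₂ q) = Disjoint-namesL A ds p q

  Occurs : Fm → ℕ → At → Set
  Occurs (atom a x) z α = (z ≡ x) × (α ≡ a)
  Occurs (A ∨ B) z α = Occurs A z α ⊎ Occurs B z α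
  Occurs (A ∧ B) z α = Occurs A z α ⊎ Occurs B z α

  Occursᴸ : List Fm → ℕ → At → Set
  Occursᴸ Δ z α = Any (λ A → Occurs A z α) Δ

  Occurs⇒names : ∀ A {z α} → Occurs A z α → names A z
  Occurs⇒names (atom a x) (p , _) = p
  Occurs⇒names (A ∨ B) (inj₁ p) = inj₁ (Occurs⇒names A p)
  Occurs⇒names (A ∨ B) (inj₂ p) = inj₂ (Occurs⇒names B p)
  Occurs⇒names (A ∧ B) (inj₁ p) = inj₁ (Occurs⇒names A p)
  Occurs⇒names (A ∧ B) (inj₂ p) = inj₂ (Occurs⇒names B p)

  Occursᴸ⇒namesL : ∀ Δ {z α} → Occursᴸ Δ z α → namesL Δ z
  Occursᴸ⇒namesL (A ∷ Δ) (here p) = inj₁ (Occurs⇒names A p)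
  Occursᴸ⇒namesL (A ∷ Δ) (there p) = inj₂ (Occursᴸ⇒namesL Δ p)

  Occurs-neg : ∀ A {z α} → Occurs A z α → Occurs (neg A) z (bar α)
  Occurs-neg (atom a x) (p , refl) = p , refl
  Occurs-neg (A ∨ B) (inj₁ p) = inj₁ (Occurs-neg A p)
  Occurs-neg (A ∨ B) (inj₂ p) = inj₂ (Occurs-neg B p)
  Occurs-neg (A ∧ B) (inj₁ p) = inj₁ (Occurs-neg A p)
  Occurs-neg (A ∧ B) (inj₂ p) = inj₂ (Occurs-neg B p)

  neg-Occurs : ∀ A {z α} → Occurs (neg A) z α → Occurs A z (bar α)
  neg-Occurs (atom a x) (p , refl) = p , bar-involutive a
  neg-Occurs (A ∨ B) (inj₁ p) = inj₁ (neg-Occurs A p)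
  neg-Occurs (A ∨ B) (inj₂ p) = inj₂ (neg-Occurs B p)
  neg-Occurs (A ∧ B) (inj₁ p) = inj₁ (neg-Occurs A p)
  neg-Occurs (A ∧ B) (inj₂ p) = inj₂ (neg-Occurs B p)

  Occurs-functional-⊎ : ∀ A B → SharingFree A × SharingFree B × Disjoint (names A) (names B) →
    ∀ {z α β} → Occurs A z α ⊎ Occurs B z α → Occurs A z β ⊎ Occurs B z β → α ≡ β

  Occurs-functional : ∀ A → SharingFree A → ∀ {z α β} → Occurs A z α → Occurs A z β → α ≡ β
  Occurs-functional (atom a x) _ (_ , refl) (_ , refl) = refl
  Occurs-functional (A ∨ B) sf p q = Occurs-functional-⊎ A B sf p q
  Occurs-functional (A ∧ B) sf p q = Occurs-functional-⊎ A B sf p q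


  Occurs-functional-⊎ A B (sA , sB , d) (inj₁ p) (inj₁ q) = Occurs-functional A sA p q
  Occurs-functional-⊎ A B (sA , sB , d) (inj₂ p) (inj₂ q) = Occurs-functional B sB p q
  Occurs-functional-⊎ A B (sA , sB , d) (inj₁ p) (inj₂ q) = ⊥-elim (d _ (Occurs⇒names A p) (Occurs⇒names B q))
  Occurs-functional-⊎ A B (sA , sB , d) (inj₂ p) (inj₁ q) = ⊥-elim (d _ (Occurs⇒names A q) (Occurs⇒names B p))

  Occursᴸ-functional : ∀ Δ → WF Δ → ∀ {z α β} → Occursᴸ Δ z α → Occursᴸ Δ z β → α ≡ β
  Occursᴸ-functional (A ∷ Δ) (sA ∷ _ , _) (here p) (here q) = Occurs-functional A sA p q
  Occursᴸ-functional (A ∷ Δ) (_ , d ∷ _) (here p) (there q) =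
    ⊥-elim (Disjoint-namesL A d (Occurs⇒names A p) (Occursᴸ⇒namesL Δ q))
  Occursᴸ-functional (A ∷ Δ) (_ , d ∷ _) (there p) (here q) =
    ⊥-elim (Disjoint-namesL A d (Occurs⇒names A q) (Occursᴸ⇒namesL Δ p))
  Occursᴸ-functional (A ∷ Δ) (_ ∷ sΔ , _ ∷ dΔ) (there p) (there q) = Occursᴸ-functional Δ (sΔ , dΔ) p q

  namesL-atomic : ∀ Γ → All IsAtomic Γ → ∀ {z} → namesL Γ z → Σ At λ α → atom α z ∈ Γ
  namesL-atomic (atom a x ∷ Γ) _ (inj₁ refl) = a , here refl
  namesL-atomic (_ ∷ Γ) (_ ∷ at) (inj₂ p) = let (α , m) = namesL-atomic Γ at p in α , there m

  ∈⇒Occursᴸ : ∀ {Γ α z} → atom α z ∈ Γ → Occursᴸ Γ z α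
  ∈⇒Occursᴸ (here refl) = here (refl , refl)
  ∈⇒Occursᴸ (there m) = there (∈⇒Occursᴸ m)

  Br-resp-≐ : ∀ A {X Y} → X ≐ Y → Br A X → Br A Y
  Br-resp-≐ (atom a x) f (lift e) = lift (≐-trans (≐-sym f) e)
  Br-resp-≐ (A ∨ B) f (Y , Z , p , q , lift e) = Y , Z , p , q , lift (≐-trans (≐-sym f) e)
  Br-resp-≐ (A ∧ B) f (inj₁ p) = inj₁ (Br-resp-≐ A f p)
  Br-resp-≐ (A ∧ B) f (inj₂ p) = inj₂ (Br-resp-≐ B f p)

  Br⊆names : ∀ A {X} → Br A X → X ⊆ names A
  Br⊆names (atom a x) (lift e) z p = to e p
  Br⊆names (A ∨ B) (Y , Z , p , q , lift e) z r with to e r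
  ... | inj₁ y = inj₁ (Br⊆names A p z y)
  ... | inj₂ y = inj₂ (Br⊆names B q z y)
  Br⊆names (A ∧ B) (inj₁ p) z r = inj₁ (Br⊆names A p z r)
  Br⊆names (A ∧ B) (inj₂ p) z r = inj₂ (Br⊆names B p z r)

  some-Br : ∀ A → Σ Subset (Br A)
  some-Br (atom a x) = ⟦ x ⟧ , lift ≐-refl
  some-Br (A ∨ B) with some-Br A | some-Br B
  ... | X , p | Y , q = (X ∪ Y) , X , Y , p , q , lift ≐-refl
  some-Br (A ∧ B) with some-Br A
  ... | X , p = X , inj₁ p

  Br-∪⁻ˡ : ∀ A {P X} → Br A (X ∩ (names A ∪ P)) → Br A (X ∩ names A)
  Br-∪⁻ˡ A b = Br-resp-≐ A (λ z → (λ p → proj₁ p , Br⊆names A b z p) , (λ { (x , a) → x , inj₁ a })) b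

  Br-∪⁻ʳ : ∀ A {P X} → Br A (X ∩ (P ∪ names A)) → Br A (X ∩ names A)
  Br-∪⁻ʳ A b = Br-resp-≐ A (λ z → (λ p → proj₁ p , Br⊆names A b z p) , (λ { (x , a) → x , inj₂ a })) b

  Br-∨⁻ : ∀ A B {X} → Disjoint (names A) (names B) → Br (A ∨ B) (X ∩ names (A ∨ B)) →
          Br A (X ∩ names A) × Br B (X ∩ names B)
  Br-∨⁻ A B {X} d (Y , Z , bY , bZ , lift e) = Br-resp-≐ A (≐-sym eY) bY , Br-resp-≐ B (≐-sym eZ) bZ
    where
    eY : (X ∩ names A) ≐ Y
    eY z = (λ { (x , a) → [ (λ y → y) , (λ w → ⊥-elim (d z a (Br⊆names B bZ z w))) ]′ (to e (x , inj₁ a)) }) ,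
           (λ y → proj₁ (from e (inj₁ y)) , Br⊆names A bY z y)
    eZ : (X ∩ names B) ≐ Z
    eZ z = (λ { (x , b) → [ (λ y → ⊥-elim (d z (Br⊆names A bY z y) b)) , (λ w → w) ]′ (to e (x , inj₂ b)) }) ,
           (λ w → proj₁ (from e (inj₂ w)) , Br⊆names B bZ z w)

  BrL-∨⁻ : ∀ A B {Γ X} → Disjoint (names A) (names B) → BrL (A ∨ B ∷ Γ) X → BrL (A ∷ B ∷ Γ) X
  BrL-∨⁻ A B {Γ} d (lift s , b ∷ bs) =
    let (bA , bB) = Br-∨⁻ A B d b in
    lift (λ z q → to (∪-assoc (names A) (names B) (namesL Γ)) (s z q)) , bA ∷ bB ∷ bs

  BrL-∧⁻ : ∀ A B {Γ X} → BrL (A ∧ B ∷ Γ) X → BrL (A ∷ Γ) X ⊎ BrL (B ∷ Γ) X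
  BrL-∧⁻ A B (lift s , inj₁ bA ∷ bs) =
    inj₁ (lift (λ z r → map₁ [ (λ a → a) , (λ b → Br⊆names A bA z (r , inj₂ b)) ]′ (s z r)) ,
          Br-∪⁻ˡ A bA ∷ bs)
  BrL-∧⁻ A B (lift s , inj₂ bB ∷ bs) =
    inj₂ (lift (λ z r → map₁ [ (λ a → Br⊆names B bB z (r , inj₁ a)) , (λ b → b) ]′ (s z r)) ,
          Br-∪⁻ʳ B bB ∷ bs)

  Brs-restrict : ∀ {W P} Δ → namesL Δ ⊆ P →
    All (λ A → Br A (W ∩ names A)) Δ → All (λ A → Br A ((W ∩ P) ∩ names A)) Δ
  Brs-restrict [] _ [] = []
  Brs-restrict (A ∷ Δ) s (b ∷ bs) =
    Br-resp-≐ A (λ z → (λ { (w , a) → (w , s z (inj₁ a)) , a }) , (λ { ((w , _) , a) → w , a })) b ∷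
    Brs-restrict Δ (λ z p → s z (inj₂ p)) bs

  BrL-++⁻ : ∀ Δ {Γ W} → BrL (Δ ++ Γ) W → BrL Δ (W ∩ namesL Δ) × BrL Γ (W ∩ namesL Γ)
  BrL-++⁻ Δ {Γ} (_ , bs) with Allₚ.++⁻ Δ bs
  ... | bΔ , bΓ = (lift (λ z → proj₂) , Brs-restrict Δ (λ z p → p) bΔ) ,
                  (lift (λ z → proj₂) , Brs-restrict Γ (λ z p → p) bΓ)

  Brs-atomic : ∀ {P} Γ → All IsAtomic Γ → namesL Γ ⊆ P → All (λ B → Br B (P ∩ names B)) Γ
  Brs-atomic [] [] _ = []
  Brs-atomic (atom a x ∷ Γ) (_ ∷ at) s =
    lift (λ z → proj₂ , λ { refl → s x (inj₁ refl) , refl }) ∷ Brs-atomic Γ at (λ z p → s z (inj₂ p))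

  BrL-resp-↭ : ∀ {Γ Δ X} → Γ ↭ Δ → BrL Γ X → BrL Δ X
  BrL-resp-↭ p (lift s , bs) = lift (λ z q → to (namesL-resp-↭ p) (s z q)) , All-resp-↭ p bs

  BrL-atom : ∀ {Γ Y α x} → BrL Γ Y → atom α x ∈ Γ → Y x
  BrL-atom {Y = Y} (_ , bs) = atom-in bs
    where
    atom-in : ∀ {Δ α x} → All (λ A → Br A (Y ∩ names A)) Δ → atom α x ∈ Δ → Y x
    atom-in (lift e ∷ _) (here refl) = proj₁ (from e refl)
    atom-in (_ ∷ bs) (there p) = atom-in bs p

  BrL-atomic : ∀ Γ → All IsAtomic Γ → BrL Γ (namesL Γ)
  BrL-atomic Γ at = lift (λ z p → p) , Brs-atomic Γ at (λ z p → p)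

  BrL-atomic-≐ : ∀ Γ → All IsAtomic Γ → ∀ {Y} → BrL Γ Y → Y ≐ namesL Γ
  BrL-atomic-≐ Γ at b@(lift s , _) z = s z , λ n → BrL-atom b (proj₂ (namesL-atomic Γ at n))

  WF-resp-↭ : ∀ {Γ Δ} → Γ ↭ Δ → WF Γ → WF Δ
  WF-resp-↭ p (s , d) = All-resp-↭ p s , pairs p d
    where
    pairs : ∀ {Γ Δ} → Γ ↭ Δ → AllPairs (λ A B → Disjoint (names A) (names B)) Γ →
            AllPairs (λ A B → Disjoint (names A) (names B)) Δ
    pairs ↭-refl d = d
    pairs (prep x p) (a ∷ d) = All-resp-↭ p a ∷ pairs p d
    pairs (swap x y p) ((r ∷ a₁) ∷ a₂ ∷ d) =
      ((λ z b a → r z a b) ∷ All-resp-↭ p a₂) ∷ All-resp-↭ p a₁ ∷ pairs p d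
    pairs (↭-trans p q) d = pairs q (pairs p d)

  WF-[_] : ∀ {A} → SharingFree A → WF (A ∷ [])
  WF-[ s ] = s ∷ [] , [] ∷ []

  some-BrL : ∀ Γ → WF Γ → Σ Subset (BrL Γ)
  some-BrL [] _ = ∅ , lift (λ z ()) , []
  some-BrL (A ∷ Γ) (sA ∷ sΓ , dA ∷ dΓ) with some-Br A | some-BrL Γ (sΓ , dΓ)
  ... | X , bX | Y , lift sY , bsY = (X ∪ Y) , lift sub , Br-resp-≐ A headEq bX ∷ tail dA bsY
    where
    sub : (X ∪ Y) ⊆ namesL (A ∷ Γ)
    sub z (inj₁ q) = inj₁ (Br⊆names A bX z q)
    sub z (inj₂ q) = inj₂ (sY z q)
    headEq : X ≐ ((X ∪ Y) ∩ names A)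
    headEq z = (λ q → inj₁ q , Br⊆names A bX z q) ,
               (λ { (inj₁ q , _) → q ; (inj₂ q , a) → ⊥-elim (Disjoint-namesL A dA a (sY z q)) })
    tail : ∀ {Δ} → All (λ B → Disjoint (names A) (names B)) Δ → All (λ B → Br B (Y ∩ names B)) Δ →
           All (λ B → Br B ((X ∪ Y) ∩ names B)) Δ
    tail [] [] = []
    tail {B ∷ Δ} (d ∷ ds) (b ∷ bs) =
      Br-resp-≐ B (λ z → (λ { (q , r) → inj₂ q , r }) ,
                         (λ { (inj₁ q , r) → ⊥-elim (d z (Br⊆names A bX z q) r) ; (inj₂ q , r) → q , r })) b ∷
      tail ds bs

  Br-or-Br-neg : ∀ B {Zero One : ℕ → Set₁} → (∀ z → names B z → Zero z ⊎ One z) →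
    (Σ Subset λ Z → Br B Z × (∀ z → Z z → Zero z)) ⊎ (Σ Subset λ W → Br (neg B) W × (∀ z → W z → One z))
  Br-or-Br-neg (atom a x) f with f x refl
  ... | inj₁ p = inj₁ (⟦ x ⟧ , lift ≐-refl , λ { z refl → p })
  ... | inj₂ p = inj₂ (⟦ x ⟧ , lift ≐-refl , λ { z refl → p })
  Br-or-Br-neg (B ∨ C) f with Br-or-Br-neg B (λ z p → f z (inj₁ p)) | Br-or-Br-neg C (λ z p → f z (inj₂ p))
  ... | inj₂ (W , b , h) | _ = inj₂ (W , inj₁ b , h)
  ... | inj₁ _ | inj₂ (W , b , h) = inj₂ (W , inj₂ b , h)
  ... | inj₁ (Z₁ , b₁ , h₁) | inj₁ (Z₂ , b₂ , h₂) =
    inj₁ ((Z₁ ∪ Z₂) , (Z₁ , Z₂ , b₁ , b₂ , lift ≐-refl) , λ z → [ h₁ z , h₂ z ]′)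
  Br-or-Br-neg (B ∧ C) f with Br-or-Br-neg B (λ z p → f z (inj₁ p)) | Br-or-Br-neg C (λ z p → f z (inj₂ p))
  ... | inj₁ (Z , b , h) | _ = inj₁ (Z , inj₁ b , h)
  ... | inj₂ _ | inj₁ (Z , b , h) = inj₁ (Z , inj₂ b , h)
  ... | inj₂ (W₁ , b₁ , h₁) | inj₂ (W₂ , b₂ , h₂) =
    inj₂ ((W₁ ∪ W₂) , (W₁ , W₂ , b₁ , b₂ , lift ≐-refl) , λ z → [ h₁ z , h₂ z ]′)

  -- Correct graphs

  Complementaryᴸ : List Fm → ℕ → ℕ → Set
  Complementaryᴸ Δ a b = Σ At λ α → Occursᴸ Δ a α × Occursᴸ Δ b (bar α)

  Complementaryᴸ-map : ∀ {Δ Δ′ a b} → (∀ {z α} → Occursᴸ Δ z α → Occursᴸ Δ′ z α) →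
    Complementaryᴸ Δ a b → Complementaryᴸ Δ′ a b
  Complementaryᴸ-map f (α , p , q) = α , f p , f q

  Covered : BLG → Subset → Set₁
  Covered G X = Σ ℕ λ a → Σ ℕ λ b → Σ Subset λ Y → E G a b Y × X a × X b

  Covered-⊔ˡ : ∀ {G H X} → Covered G X → Covered (G ⊔ H) X
  Covered-⊔ˡ (a , b , Y , e , p , q) = a , b , Y , inj₁ e , p , q

  Covered-⊔ʳ : ∀ {G H X} → Covered H X → Covered (G ⊔ H) X
  Covered-⊔ʳ (a , b , Y , e , p , q) = a , b , Y , inj₂ e , p , q

  record Correct (Δ : List Fm) (G : BLG) : Set₂ where
    field
      vertices      : V G ≐ namesL Δ
      complementary : ∀ {a b Y} → E G a b Y → Complementaryᴸ Δ a b
      label⊆        : ∀ {a b Y} → E G a b Y → Y ⊆ namesL Δ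
      label-atoms   : ∀ {a b Y α x} → E G a b Y → atom α x ∈ Δ → Y x
      covers        : ∀ {X} → BrL Δ X → Covered G X
      edge?         : ∀ a b → Dec (Σ Subset (E G a b))
  open Correct

  Correct-resp-↭ : ∀ {Δ Δ′ G} → Δ ↭ Δ′ → Correct Δ G → Correct Δ′ G
  Correct-resp-↭ p c = record
    { vertices = ≐-trans (vertices c) (namesL-resp-↭ p)
    ; complementary = λ e → Complementaryᴸ-map (Any-resp-↭ p) (complementary c e)
    ; label⊆ = λ e z q → to (namesL-resp-↭ p) (label⊆ c e z q)
    ; label-atoms = λ e m → label-atoms c e (Any-resp-↭ (↭-sym p) m)
    ; covers = λ b → covers c (BrL-resp-↭ (↭-sym p) b)
    ; edge? = edge? c
    }

  Correct-swap : ∀ {A B G} → Correct (A ∷ B ∷ []) G → Correct (B ∷ A ∷ []) G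
  Correct-swap = Correct-resp-↭ (swap _ _ ↭-refl)

  ⊔-edge? : ∀ {G H a b} → Dec (Σ Subset (E G a b)) → Dec (Σ Subset (E H a b)) → Dec (Σ Subset (E (G ⊔ H) a b))
  ⊔-edge? d d′ = map′ (λ { (inj₁ (X , e)) → X , inj₁ e ; (inj₂ (X , e)) → X , inj₂ e })
                      (λ { (X , inj₁ e) → inj₁ (X , e) ; (X , inj₂ e) → inj₂ (X , e) })
                      (d ⊎-dec d′)

  Correct-⊔ : ∀ {Δ G H} → Correct Δ G → Correct Δ H → Correct Δ (G ⊔ H)
  Correct-⊔ {G = G} {H} c d = record
    { vertices = λ z → [ to (vertices c) , to (vertices d) ]′ , (λ n → inj₁ (from (vertices c) n))
    ; complementary = [ complementary c , complementary d ]′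
    ; label⊆ = [ label⊆ c , label⊆ d ]′
    ; label-atoms = λ { (inj₁ e) → label-atoms c e ; (inj₂ e) → label-atoms d e }
    ; covers = λ b → Covered-⊔ˡ {G} {H} (covers c b)
    ; edge? = λ a b → ⊔-edge? {G} {H} (edge? c a b) (edge? d a b)
    }

  Correct-∨ : ∀ {A B Γ G} → Disjoint (names A) (names B) → Correct (A ∷ B ∷ Γ) G → Correct (A ∨ B ∷ Γ) G
  Correct-∨ {A} {B} {Γ} d c = record
    { vertices = ≐-trans (vertices c) (≐-sym assoc)
    ; complementary = λ e → Complementaryᴸ-map merge (complementary c e)
    ; label⊆ = λ e z q → from assoc (label⊆ c e z q)
    ; label-atoms = λ { e (here ()) ; e (there m) → label-atoms c e (there (there m)) }
    ; covers = λ b → covers c (BrL-∨⁻ A B d b)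
    ; edge? = edge? c
    }
    where
    assoc : ((names A ∪ names B) ∪ namesL Γ) ≐ (names A ∪ (names B ∪ namesL Γ))
    assoc = ∪-assoc (names A) (names B) (namesL Γ)
    merge : ∀ {Γ z α} → Occursᴸ (A ∷ B ∷ Γ) z α → Occursᴸ (A ∨ B ∷ Γ) z α
    merge (here p) = here (inj₁ p)
    merge (there (here p)) = here (inj₂ p)
    merge (there (there p)) = there p

  Correct-∧ : ∀ {A B Γ G H} → Correct (A ∷ Γ) G → Correct (B ∷ Γ) H → Correct (A ∧ B ∷ Γ) (G ⊔ H)
  Correct-∧ {A} {B} {Γ} {G} {H} c d = record
    { vertices = λ z →
        [ (λ v → map₁ inj₁ (to (vertices c) v)) , (λ v → map₁ inj₂ (to (vertices d) v)) ]′ ,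
        (λ { (inj₁ (inj₁ a)) → inj₁ (from (vertices c) (inj₁ a))
           ; (inj₁ (inj₂ b)) → inj₂ (from (vertices d) (inj₁ b))
           ; (inj₂ g) → inj₁ (from (vertices c) (inj₂ g)) })
    ; complementary = [ (λ e → Complementaryᴸ-map (into inj₁) (complementary c e)) ,
                        (λ e → Complementaryᴸ-map (into inj₂) (complementary d e)) ]′
    ; label⊆ = [ (λ e z q → map₁ inj₁ (label⊆ c e z q)) , (λ e z q → map₁ inj₂ (label⊆ d e z q)) ]′
    ; label-atoms = λ { _ (here ())
                      ; (inj₁ e) (there m) → label-atoms c e (there m)
                      ; (inj₂ e) (there m) → label-atoms d e (there m) }
    ; covers = λ b → [ (λ bA → Covered-⊔ˡ {G} {H} (covers c bA)) ,
                       (λ bB → Covered-⊔ʳ {G} {H} (covers d bB)) ]′ (BrL-∧⁻ A B b)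
    ; edge? = λ a b → ⊔-edge? {G} {H} (edge? c a b) (edge? d a b)
    }
    where
    into : ∀ {C z α} → (Occurs C z α → Occurs (A ∧ B) z α) →
           Occursᴸ (C ∷ Γ) z α → Occursᴸ (A ∧ B ∷ Γ) z α
    into f (here p) = here (f p)
    into f (there p) = there p

  Correct-wk : ∀ {Δ Γ G} → WF Γ → Correct Δ G → Correct (Δ ++ Γ) (wk Γ G)
  Correct-wk {Δ} {Γ} {G} w c = record
    { vertices = ≐-trans (∪-cong (vertices c) ≐-refl) (≐-sym (namesL-++ Δ))
    ; complementary = λ { (_ , _ , e , _) → Complementaryᴸ-map Anyₚ.++⁺ˡ (complementary c e) }
    ; label⊆ = λ { (_ , _ , e , (lift sY , _) , lift eq) z p →
        from (namesL-++ Δ) (Data.Sum.map (label⊆ c e z) (sY z) (to eq p)) }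
    ; label-atoms = λ { (_ , _ , e , bY , lift eq) m →
        from eq (Data.Sum.map (label-atoms c e) (BrL-atom bY) (Anyₚ.++⁻ Δ m)) }
    ; covers = cover
    ; edge? = λ a b → map′ (λ (X , e) → (X ∪ Y₀) , X , Y₀ , e , bY₀ , lift ≐-refl)
                           (λ (_ , X , _ , e , _) → X , e)
                           (edge? c a b)
    }
    where
    Y₀ = proj₁ (some-BrL Γ w)
    bY₀ = proj₂ (some-BrL Γ w)
    cover : ∀ {W} → BrL (Δ ++ Γ) W → Covered (wk Γ G) W
    cover {W} b with BrL-++⁻ Δ b
    ... | bΔ , bΓ with covers c bΔ
    ... | a , a′ , X , e , (wa , _) , (wb , _) =
      a , a′ , (X ∪ (W ∩ namesL Γ)) , (X , _ , e , bΓ , lift ≐-refl) , wa , wb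

  u∨-injective : ∀ {a b c d} → a u∨ b ≡ c u∨ d → a ≡ c × b ≡ d
  u∨-injective refl = refl , refl

  u∧-injective : ∀ {a b c d} → a u∧ b ≡ c u∧ d → a ≡ c × b ≡ d
  u∧-injective refl = refl , refl

  Dual : Fm → Fm → Set
  Dual (atom a x) (atom b y) = b ≡ bar a
  Dual (A₁ ∨ A₂) (C₁ ∧ C₂) = Dual A₁ C₁ × Dual A₂ C₂
  Dual (A₁ ∧ A₂) (C₁ ∨ C₂) = Dual C₁ A₁ × Dual C₂ A₂
  Dual _ _ = ⊥

  Dual-sym : ∀ A C → Dual A C → Dual C A
  Dual-sym (atom a x) (atom b y) refl = sym (bar-involutive a)
  Dual-sym (A₁ ∨ A₂) (C₁ ∧ C₂) d = d
  Dual-sym (A₁ ∧ A₂) (C₁ ∨ C₂) d = d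

  erase≡⇒Dual-neg : ∀ A B → erase A ≡ erase B → Dual A (neg B)
  erase≡⇒Dual-neg (atom a x) (atom .a y) refl = refl
  erase≡⇒Dual-neg (A₁ ∨ A₂) (B₁ ∨ B₂) e with u∨-injective e
  ... | e₁ , e₂ = erase≡⇒Dual-neg A₁ B₁ e₁ , erase≡⇒Dual-neg A₂ B₂ e₂
  erase≡⇒Dual-neg (A₁ ∧ A₂) (B₁ ∧ B₂) e with u∧-injective e
  ... | e₁ , e₂ = Dual-sym A₁ (neg B₁) (erase≡⇒Dual-neg A₁ B₁ e₁) ,
                  Dual-sym A₂ (neg B₂) (erase≡⇒Dual-neg A₂ B₂ e₂)
  erase≡⇒Dual-neg (atom a x) (B₁ ∨ B₂) ()
  erase≡⇒Dual-neg (atom a x) (B₁ ∧ B₂) ()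
  erase≡⇒Dual-neg (A₁ ∨ A₂) (atom a x) ()
  erase≡⇒Dual-neg (A₁ ∨ A₂) (B₁ ∧ B₂) ()
  erase≡⇒Dual-neg (A₁ ∧ A₂) (atom a x) ()
  erase≡⇒Dual-neg (A₁ ∧ A₂) (B₁ ∨ B₂) ()

  Correct-∨ˡ-wk : ∀ {C D F G} → SharingFree F → Disjoint (names D) (names F) →
    Correct (D ∷ C ∷ []) G → Correct (C ∷ D ∨ F ∷ []) (wk (F ∷ []) G)
  Correct-∨ˡ-wk {C} {D} {F} sF d c =
    Correct-swap (Correct-∨ d (Correct-resp-↭ (prep D (swap C F ↭-refl)) (Correct-wk WF-[ sF ] c)))

  Correct-∨ʳ-wk : ∀ {C D F G} → SharingFree D → Disjoint (names D) (names F) →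
    Correct (F ∷ C ∷ []) G → Correct (C ∷ D ∨ F ∷ []) (wk (D ∷ []) G)
  Correct-∨ʳ-wk {C} {D} {F} sD d c =
    Correct-swap (Correct-∨ d (Correct-resp-↭ (↭-trans (prep F (swap C D ↭-refl)) (swap F D ↭-refl))
                                               (Correct-wk WF-[ sD ] c)))

  idg-correct : ∀ A C → Dual A C → SharingFree A → SharingFree C → Correct (A ∷ C ∷ []) (idg A C)
  idg-correct (atom a x) (atom .(bar a) y) refl _ _ = record
    { vertices = λ z → map₂ inj₁ , [ inj₁ , [ inj₂ , (λ ()) ]′ ]′
    ; complementary = λ
        { (lift (inj₁ (refl , refl)) , _) → a , here (refl , refl) , there (here (refl , refl))
        ; (lift (inj₂ (refl , refl)) , _) → bar a , there (here (refl , refl)) , here (refl , bar-involutive a) }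
    ; label⊆ = λ { (_ , lift e) z p → map₂ inj₁ (to e p) }
    ; label-atoms = λ { (_ , lift e) (here refl) → from e (inj₁ refl)
                      ; (_ , lift e) (there (here refl)) → from e (inj₂ refl) }
    ; covers = λ { (_ , lift ex ∷ lift ey ∷ []) →
        x , y , ⟦ x ، y ⟧ , (lift (inj₁ (refl , refl)) , lift ≐-refl) , proj₁ (from ex refl) , proj₁ (from ey refl) }
    ; edge? = λ u v → map′ (λ p → ⟦ x ، y ⟧ , lift p , lift ≐-refl) (λ (_ , lift p , _) → p)
                           (((u ≟ x) ×-dec (v ≟ y)) ⊎-dec ((u ≟ y) ×-dec (v ≟ x)))
    }
  idg-correct (A₁ ∨ A₂) (C₁ ∧ C₂) (d₁ , d₂) (sA₁ , sA₂ , dA) (sC₁ , sC₂ , _) =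
    Correct-swap (Correct-∧ (Correct-∨ˡ-wk sA₂ dA (idg-correct A₁ C₁ d₁ sA₁ sC₁))
                            (Correct-∨ʳ-wk sA₁ dA (idg-correct A₂ C₂ d₂ sA₂ sC₂)))
  idg-correct (A₁ ∧ A₂) (C₁ ∨ C₂) (d₁ , d₂) (sA₁ , sA₂ , _) (sC₁ , sC₂ , dC) =
    Correct-∧ (Correct-∨ˡ-wk sC₂ dC (idg-correct C₁ A₁ d₁ sC₁ sA₁))
              (Correct-∨ʳ-wk sC₁ dC (idg-correct C₂ A₂ d₂ sC₂ sA₂))

  Deriv-WF : ∀ {Δ} → Deriv Δ → WF Δ
  Deriv-WF (ax _ _ _ _ w _) = w
  Deriv-WF (cut _ _ _ _ w _) = w
  Deriv-WF (sup _ _ _ w _) = w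
  Deriv-WF (or _ _ _ _ w _) = w
  Deriv-WF (and _ _ _ _ _ w _) = w

  ⟪⟫-correct : ∀ {Δ} (P : Deriv Δ) → CutFree P → Correct Δ ⟪ P ⟫
  ⟪⟫-correct (ax Γ A B e w p) _ with WF-resp-↭ p w
  ... | sA ∷ sB ∷ sΓ , _ ∷ _ ∷ dΓ =
    Correct-resp-↭ (↭-sym p) (Correct-wk (sΓ , dΓ) (idg-correct A (neg B) (erase≡⇒Dual-neg A B e) sA sB))
  ⟪⟫-correct (sup Γ P Q w p) (cP , cQ) =
    Correct-resp-↭ (↭-sym p) (Correct-⊔ (⟪⟫-correct P cP) (⟪⟫-correct Q cQ))
  ⟪⟫-correct (or Γ A B P w p) cP with WF-resp-↭ p w
  ... | (_ , _ , d) ∷ _ , _ = Correct-resp-↭ (↭-sym p) (Correct-∨ d (⟪⟫-correct P cP))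
  ⟪⟫-correct (and Γ A B P Q w p) (cP , cQ) =
    Correct-resp-↭ (↭-sym p) (Correct-∧ (⟪⟫-correct P cP) (⟪⟫-correct Q cQ))

  ¬¬-∀∈ : ∀ {ℓ} {B : Set} {Q : B → Set ℓ} (xs : List B) →
    (∀ x → ¬ ¬ Q x) → ¬ ¬ (∀ {x} → x ∈ xs → Q x)
  ¬¬-∀∈ [] q k = k λ ()
  ¬¬-∀∈ (x ∷ xs) q k = ¬¬-∀∈ xs q λ f → q x λ qx → k λ { (here refl) → qx ; (there m) → f m }

  -- Colourings of names

  module Colouring (A : Fm) (sA : SharingFree A) where

    SameAtom DualAtom : ℕ → ℕ → Set
    SameAtom z z′ = Σ At λ α → Occurs A z α × Occurs A z′ α
    DualAtom z z′ = Σ At λ α → Occurs A z α × Occurs A z′ (bar α)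

    SameAtom-sym : ∀ {z z′} → SameAtom z z′ → SameAtom z′ z
    SameAtom-sym (α , p , q) = α , q , p

    DualAtom-sym : ∀ {z z′} → DualAtom z z′ → DualAtom z′ z
    DualAtom-sym (α , p , q) = bar α , q , subst (Occurs A _) (sym (bar-involutive α)) p

    DualAtom-irreflexive : ∀ {z} → DualAtom z z → ⊥
    DualAtom-irreflexive (α , p , q) = bar-irreflexive α (sym (Occurs-functional A sA p q))

    SameAtom-trans : ∀ {z z₀ z′} → SameAtom z z₀ → SameAtom z z′ → SameAtom z₀ z′
    SameAtom-trans (α , p , q) (β , r , t) with Occurs-functional A sA p r
    ... | refl = α , q , t

    SameAtom-DualAtom : ∀ {z z₀ z′} → SameAtom z z₀ → DualAtom z z′ → DualAtom z₀ z′
    SameAtom-DualAtom (α , p , q) (β , r , t) with Occurs-functional A sA p r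
    ... | refl = α , q , t

    DualAtom-DualAtom : ∀ {z z₀ z′} → DualAtom z z₀ → DualAtom z z′ → SameAtom z₀ z′
    DualAtom-DualAtom (α , p , q) (β , r , t) with Occurs-functional A sA p r
    ... | refl = bar α , q , t

    Proper : List ℕ → (ℕ → Bool) → Set
    Proper zs c = ∀ {z z′} → z ∈ zs → z′ ∈ zs →
      (DualAtom z z′ → c z ≢ c z′) × (SameAtom z z′ → c z ≡ c z′)

    Compatible : List ℕ → (ℕ → Bool) → ℕ → Bool → Set
    Compatible zs c z b = ∀ {z′} → z′ ∈ zs → (DualAtom z z′ → b ≢ c z′) × (SameAtom z z′ → b ≡ c z′)

    _[_≔_] : (ℕ → Bool) → ℕ → Bool → ℕ → Bool
    (c [ z ≔ b ]) w with w ≟ z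
    ... | yes _ = b
    ... | no _ = c w

    update-≡ : ∀ c z b → (c [ z ≔ b ]) z ≡ b
    update-≡ c z b with z ≟ z
    ... | yes _ = refl
    ... | no z≢z = ⊥-elim (z≢z refl)

    update-≢ : ∀ c z b {w} → w ≢ z → (c [ z ≔ b ]) w ≡ c w
    update-≢ c z b {w} w≢z with w ≟ z
    ... | yes w≡z = ⊥-elim (w≢z w≡z)
    ... | no _ = refl

    Proper-∷-∈ : ∀ {z zs c} → z ∈ zs → Proper zs c → Proper (z ∷ zs) c
    Proper-∷-∈ m p (here refl) (here refl) = (λ d _ → DualAtom-irreflexive d) , (λ _ → refl)
    Proper-∷-∈ m p (here refl) (there m′) = p m m′
    Proper-∷-∈ m p (there m₁) (here refl) = p m₁ m
    Proper-∷-∈ m p (there m₁) (there m′) = p m₁ m′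

    Proper-∷-∉ : ∀ {z zs c} → z ∉ zs → Proper zs c →
      ∀ b → Compatible zs c z b → Proper (z ∷ zs) (c [ z ≔ b ])
    Proper-∷-∉ {z} {zs} {c} z∉ p b comp = proper
      where
      ≢z : ∀ {z′} → z′ ∈ zs → z′ ≢ z
      ≢z m refl = z∉ m
      proper : Proper (z ∷ zs) (c [ z ≔ b ])
      proper (here refl) (here refl) = (λ d _ → DualAtom-irreflexive d) , (λ _ → refl)
      proper (here refl) (there m′) rewrite update-≡ c z b | update-≢ c z b (≢z m′) = comp m′
      proper (there m) (here refl) rewrite update-≡ c z b | update-≢ c z b (≢z m) =
        (λ d e → proj₁ (comp m) (DualAtom-sym d) (sym e)) , (λ s → sym (proj₂ (comp m) (SameAtom-sym s)))
      proper (there m) (there m′) rewrite update-≢ c z b (≢z m) | update-≢ c z b (≢z m′) = p m m′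

    not≢ : ∀ b → not b ≢ b
    not≢ true ()
    not≢ false ()

    ¬¬-Compatible : ∀ {zs c} z → Proper zs c → ¬ ¬ Σ Bool (Compatible zs c z)
    ¬¬-Compatible {zs} {c} z p k =
      ¬¬-excluded-middle {A = SomeSame} λ
        { (yes (z₀ , m₀ , s₀)) → k (c z₀ , λ m′ → (λ d → proj₁ (p m₀ m′) (SameAtom-DualAtom s₀ d)) ,
                                                  (λ s → proj₂ (p m₀ m′) (SameAtom-trans s₀ s)))
        ; (no no-same) → ¬¬-excluded-middle {A = SomeDual} λ
          { (yes (z₀ , m₀ , d₀)) → k (not (c z₀) , λ m′ →
                (λ d e → not≢ (c z₀) (trans e (sym (proj₂ (p m₀ m′) (DualAtom-DualAtom d₀ d))))) ,
                (λ s → ⊥-elim (no-same (_ , m′ , s))))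
          ; (no no-dual) → k (true , λ m′ → (λ d → ⊥-elim (no-dual (_ , m′ , d))) ,
                                            (λ s → ⊥-elim (no-same (_ , m′ , s)))) } }
      where
      SomeSame SomeDual : Set
      SomeSame = Σ ℕ λ z₀ → z₀ ∈ zs × SameAtom z z₀
      SomeDual = Σ ℕ λ z₀ → z₀ ∈ zs × DualAtom z z₀

    ¬¬-Proper : ∀ zs → ¬ ¬ Σ (ℕ → Bool) (Proper zs)
    ¬¬-Proper [] k = k ((λ _ → true) , λ ())
    ¬¬-Proper (z ∷ zs) k = ¬¬-Proper zs λ (c , p) → ¬¬-excluded-middle {A = z ∈ zs} λ
      { (yes m) → k (c , Proper-∷-∈ m p)
      ; (no z∉) → ¬¬-Compatible z p λ (b , comp) → k (c [ z ≔ b ] , Proper-∷-∉ z∉ p b comp) }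

  -- Alternating walks through a cut against an atomic context

  module Cut (Γ : List Fm) (A : Fm) (Γ-atomic : All IsAtomic Γ)
             (wf⁺ : WF (A ∷ Γ)) (wf⁻ : WF (neg A ∷ Γ))
             {G H : BLG} (cG : Correct (A ∷ Γ) G) (cH : Correct (neg A ∷ Γ) H) where

    N I : Subset
    N = namesL Γ
    I = names A

    N∩I-empty : ∀ {z} → N z → I z → ⊥
    N∩I-empty n i = Disjoint-namesL A (AllPairs.head (proj₂ wf⁺)) i n

    WF-Γ : WF Γ
    WF-Γ = All.tail (proj₁ wf⁺) , AllPairs.tail (proj₂ wf⁺)

    data Side : Set where
      left right : Side

    opposite : Side → Side
    opposite left = right
    opposite right = left

    opposite-involutive : ∀ s → opposite (opposite s) ≡ s
    opposite-involutive left = refl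
    opposite-involutive right = refl

    graph : Side → BLG
    graph left = G
    graph right = H

    cutFormula : Side → Fm
    cutFormula left = A
    cutFormula right = neg A

    premiss : Side → List Fm
    premiss s = cutFormula s ∷ Γ

    premiss-correct : ∀ s → Correct (premiss s) (graph s)
    premiss-correct left = cG
    premiss-correct right = cH

    premiss-WF : ∀ s → WF (premiss s)
    premiss-WF left = wf⁺
    premiss-WF right = wf⁻

    names-cutFormula : ∀ s → names (cutFormula s) ≐ I
    names-cutFormula left = ≐-refl
    names-cutFormula right = names-neg A

    label∖I≐N : ∀ s {a b Y} → E (graph s) a b Y → (Y ∖ I) ≐ N
    label∖I≐N s e z =
      (λ (y , ∉I) → [ (λ c → ⊥-elim (∉I (to (names-cutFormula s) c))) , (λ n → n) ]′
                      (label⊆ (premiss-correct s) e z y)) ,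
      (λ n → label-atoms (premiss-correct s) e (there (proj₂ (namesL-atomic Γ Γ-atomic n))) , N∩I-empty n)

    Step : Side → ℕ → ℕ → Set₁
    Step s u v = EdI (graph s) I u v N

    Step-sym : ∀ {s u v} → Step s u v → Step s v u
    Step-sym (Y , inj₁ e , q) = Y , inj₂ e , q
    Step-sym (Y , inj₂ e , q) = Y , inj₁ e , q

    Step? : ∀ s u v → Dec (Step s u v)
    Step? s u v = map′ (λ { (inj₁ (Y , e)) → Y , inj₁ e , ≐-sym (label∖I≐N s e)
                          ; (inj₂ (Y , e)) → Y , inj₂ e , ≐-sym (label∖I≐N s e) })
                       (λ { (Y , inj₁ e , _) → inj₁ (Y , e) ; (Y , inj₂ e , _) → inj₂ (Y , e) })
                       (edge? (premiss-correct s) u v ⊎-dec edge? (premiss-correct s) v u)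

    Occ : Side → ℕ → At → Set
    Occ s = Occursᴸ (premiss s)

    Occ-functional : ∀ s {z α β} → Occ s z α → Occ s z β → α ≡ β
    Occ-functional s = Occursᴸ-functional (premiss s) (premiss-WF s)

    Step-complementary : ∀ {s u v α} → Step s u v → Occ s u α → Occ s v (bar α)
    Step-complementary {s} (_ , inj₁ e , _) o with complementary (premiss-correct s) e
    ... | β , ou , ov with Occ-functional s o ou
    ... | refl = ov
    Step-complementary {s} (_ , inj₂ e , _) o with complementary (premiss-correct s) e
    ... | β , ov , ou with Occ-functional s o ou
    ... | refl = subst (Occ s _) (sym (bar-involutive β)) ov

    Step-irreflexive : ∀ {s u v} → Step s u v → u ≢ v
    Step-irreflexive {s} (_ , e , _) refl with complementary (premiss-correct s) (reduce e)
    ... | β , o , o′ = bar-irreflexive β (sym (Occ-functional s o o′))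

    Occ-cross : ∀ s {z α} → I z → Occ s z α → Occ (opposite s) z (bar α)
    Occ-cross left i (here p) = here (Occurs-neg A p)
    Occ-cross right i (here p) = here (neg-Occurs A p)
    Occ-cross s i (there p) = ⊥-elim (N∩I-empty (Occursᴸ⇒namesL Γ p) i)

    Occ-side : ∀ {s s′ z α} → I z → Occ s z α → Occ s′ z α → s ≡ s′
    Occ-side {left} {left} _ _ _ = refl
    Occ-side {right} {right} _ _ _ = refl
    Occ-side {left} {right} i o o′ = ⊥-elim (bar-irreflexive _ (sym (Occ-functional right o′ (Occ-cross left i o))))
    Occ-side {right} {left} i o o′ = ⊥-elim (bar-irreflexive _ (sym (Occ-functional left o′ (Occ-cross right i o))))

    Occ⇒Occursᴸ : ∀ s {z α} → N z → Occ s z α → Occursᴸ Γ z α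
    Occ⇒Occursᴸ s n (here p) = ⊥-elim (N∩I-empty n (to (names-cutFormula s) (Occurs⇒names (cutFormula s) p)))
    Occ⇒Occursᴸ s n (there p) = p

    -- w carries ᾱ on side s, hence α on the opposite side.
    Step-Occ : ∀ {s u w α} → Step s u w → I w → Occ s u α → Occ (opposite s) w α
    Step-Occ {s} {α = α} st i o = subst (Occ (opposite s) _) (bar-involutive α) (Occ-cross s i (Step-complementary st o))

    data Walk : ℕ → Side → ℕ → Set₁ where
      last : ∀ {u s y} → Step s u y → N y → Walk u s y
      step : ∀ {u s w y} → Step s u w → I w → Walk w (opposite s) y → Walk u s y

    -- The side index of an Approach is that of its last step.
    data Approach : ℕ → Side → ℕ → Set₁ where
      first : ∀ {x s z} → N x → Step s x z → I z → Approach x s z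
      next  : ∀ {x s w z} → Approach x s w → Step (opposite s) w z → I z → Approach x (opposite s) z

    Approach-start : ∀ {x s z} → Approach x s z → N x
    Approach-start (first n _ _) = n
    Approach-start (next r _ _) = Approach-start r

    Approach-end : ∀ {x s z} → Approach x s z → I z
    Approach-end (first _ _ i) = i
    Approach-end (next _ _ i) = i

    reverse : ∀ {x s z} → Approach x s z → Walk z s x
    reverse (first n st _) = last (Step-sym st) n
    reverse {x} (next {s = s} {w = w} r st _) =
      step (Step-sym st) (Approach-end r) (subst (λ s′ → Walk w s′ x) (sym (opposite-involutive s)) (reverse r))

    append : ∀ {x s z y} → Approach x s z → Walk z (opposite s) y → Σ Side (λ s′ → Walk x s′ y)
    append (first _ st i) t = _ , step st i t
    append (next r st i) t = append r (step st i t)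

    interior : ∀ {u s y} → Walk u s y → List ℕ
    interior (last _ _) = []
    interior (step {w = w} _ _ t) = w ∷ interior t

    interior-I : ∀ {u s y} (t : Walk u s y) → All I (interior t)
    interior-I (last _ _) = []
    interior-I (step _ i t) = i ∷ interior-I t

    Walk-end : ∀ {u s y} → Walk u s y → N y
    Walk-end (last _ n) = n
    Walk-end (step _ _ t) = Walk-end t

    Walk-complementary : ∀ {u s y α} (t : Walk u s y) → Occ s u α → Occursᴸ Γ y (bar α)
    Walk-complementary {s = s} (last st n) o = Occ⇒Occursᴸ s n (Step-complementary st o)
    Walk-complementary (step st i t) o = Walk-complementary t (Step-Occ st i o)

    Walk-alternates : ∀ {u s y} (t : Walk u s y) → Alt (graph s) (graph (opposite s)) I N (u ∷ interior t ++ y ∷ [])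
    Walk-alternates (last st _) = st , lift tt
    Walk-alternates {s = left} (step st _ t) = st , Walk-alternates t
    Walk-alternates {s = right} (step st _ t) = st , Walk-alternates t

    Simple : ∀ {u s y} → Walk u s y → Set
    Simple {u} t = Unique (interior t) × u ∉ interior t

    suffix : ∀ {w s y u α} (t : Walk w s y) → Occ s w α → u ∈ interior t →
      Σ Side λ s′ → Σ (Walk u s′ y) λ t′ → Occ s′ u α ×
                    Σ (List ℕ) λ pre → interior t ≡ pre ++ u ∷ interior t′
    suffix (step st i t) o (here refl) = _ , t , Step-Occ st i o , [] , refl
    suffix (step {w = w} st i t) o (there m) with suffix t (Step-Occ st i o) m
    ... | s′ , t′ , o′ , pre , eq = s′ , t′ , o′ , w ∷ pre , cong (w ∷_) eq

    -- A revisited vertex u lies in I, so both visits leave u on the same side; cut out the loop.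
    shortcut : ∀ {u s y α} (t : Walk u s y) → Occ s u α → Σ (Walk u s y) Simple
    shortcut (last st n) o = last st n , [] , λ ()
    shortcut {u = u} {s} (step st i t) o with shortcut t (Step-Occ st i o)
    ... | t′ , simple , w∉ with u ∈? interior t′
    ... | no u∉ = step st i t′ , (¬Any⇒All¬ _ w∉ ∷ simple) ,
                  λ { (here eq) → Step-irreflexive st eq ; (there m) → u∉ m }
    ... | yes m with suffix t′ (Step-Occ st i o) m
    ... | s′ , t″ , o′ , pre , eq with Occ-side {s} {s′} (All.lookup (interior-I t′) m) o o′
    ... | refl with Unique-++⁻ʳ pre (subst Unique eq simple)
    ... | u∉ ∷ simple′ = t″ , simple′ , All¬⇒¬Any u∉

    Link : ℕ → ℕ → Set₁
    Link x y = N x × N y × x ≢ y × CompletePath G H I N x y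

    in-G : ∀ {v} → namesL (A ∷ Γ) v → V G v ⊎ V H v
    in-G p = inj₁ (from (vertices cG) p)

    SimpleWalk⇒Link : ∀ {x s y α} → N x → Occursᴸ Γ x α → (t : Walk x s y) → Simple t → Link x y
    SimpleWalk⇒Link {x} {s} {y} {α} nx ox t (unique , x∉) =
      nx , ny , x≢y , interior t , unique-path , on-path , interior-I t , N∩I-empty nx , N∩I-empty ny , alternates s t
      where
      ny = Walk-end t
      x≢y : x ≢ y
      x≢y refl = bar-irreflexive α (Occursᴸ-functional Γ WF-Γ (Walk-complementary t (there ox)) ox)
      unique-path : Unique (x ∷ interior t ++ y ∷ [])
      unique-path =
        Allₚ.++⁺ (¬Any⇒All¬ _ x∉) (x≢y ∷ []) ∷
        Uniqueₚ.++⁺ unique ([] ∷ []) (λ { (m , here refl) → N∩I-empty ny (All.lookup (interior-I t) m) })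
      on-path : All (λ v → V G v ⊎ V H v) (x ∷ interior t ++ y ∷ [])
      on-path = in-G (inj₂ nx) ∷ Allₚ.++⁺ (All.map (λ i → in-G (inj₁ i)) (interior-I t)) (in-G (inj₂ ny) ∷ [])
      alternates : ∀ s (t : Walk x s y) →
        Alt G H I N (x ∷ interior t ++ y ∷ []) ⊎ Alt H G I N (x ∷ interior t ++ y ∷ [])
      alternates left t = inj₁ (Walk-alternates t)
      alternates right t = inj₂ (Walk-alternates t)

    Walk⇒Link : ∀ {x s y} → N x → Walk x s y → Link x y
    Walk⇒Link {s = s} nx t with namesL-atomic Γ Γ-atomic nx
    ... | α , m with shortcut t (there (∈⇒Occursᴸ m))
    ... | t′ , simple = SimpleWalk⇒Link nx (∈⇒Occursᴸ m) t′ simple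

    -- Existence of a link

    open Colouring A (All.head (proj₁ wf⁺))

    Occ-cutFormula : ∀ s {z α} → I z → Occ s z α → Occurs (cutFormula s) z α
    Occ-cutFormula s i (here p) = p
    Occ-cutFormula s i (there p) = ⊥-elim (N∩I-empty (Occursᴸ⇒namesL Γ p) i)

    edge-DualAtom : ∀ s {a b Y} → E (graph s) a b Y → I a → I b → DualAtom a b
    edge-DualAtom s e ia ib with complementary (premiss-correct s) e
    edge-DualAtom left e ia ib | α , oa , ob = α , Occ-cutFormula left ia oa , Occ-cutFormula left ib ob
    edge-DualAtom right e ia ib | α , oa , ob =
      bar α , neg-Occurs A (Occ-cutFormula right ia oa) , neg-Occurs A (Occ-cutFormula right ib ob)

    Br⇒BrL-premiss : ∀ s {Z} → Br (cutFormula s) Z → BrL (premiss s) (Z ∪ N)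
    Br⇒BrL-premiss s {Z} b = lift (λ z → map₁ (Br⊆names (cutFormula s) b z)) ,
                             Br-resp-≐ (cutFormula s) restrict b ∷ Brs-atomic Γ Γ-atomic (λ z → inj₂)
      where
      restrict : Z ≐ ((Z ∪ N) ∩ names (cutFormula s))
      restrict z = (λ p → inj₁ p , Br⊆names (cutFormula s) b z p) ,
                   (λ { (inj₁ p , _) → p ; (inj₂ n , m) → ⊥-elim (N∩I-empty n (to (names-cutFormula s) m)) })

    Reached : Side → ℕ → Set₁
    Reached s z = Σ ℕ λ x → Approach x s z

    module Contradiction (no-link : ∀ {x y} → Link x y → ⊥)
                         (reached? : ∀ {z} → z ∈ nameList A → ∀ s → Dec (Reached s z))
                         (c : ℕ → Bool) (proper : Proper (nameList A) c) where

      One Zero : ℕ → Set₁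
      One z = Reached left z ⊎ (¬ Reached left z × ¬ Reached right z × c z ≡ true)
      Zero z = (¬ Reached left z × Reached right z) ⊎ (¬ Reached left z × ¬ Reached right z × c z ≡ false)

      Zero⇒¬Reached : ∀ {z} → Zero z → ¬ Reached left z
      Zero⇒¬Reached (inj₁ (¬r , _)) = ¬r
      Zero⇒¬Reached (inj₂ (¬r , _)) = ¬r

      Zero-or-One : ∀ z → I z → Zero z ⊎ One z
      Zero-or-One z i with reached? (∈-nameList A i) left | reached? (∈-nameList A i) right
      ... | yes r | _ = inj₂ (inj₁ r)
      ... | no ¬l | yes r = inj₁ (inj₁ (¬l , r))
      ... | no ¬l | no ¬r = by-colour (c z) refl
        where
        by-colour : ∀ b → c z ≡ b → Zero z ⊎ One z
        by-colour true eq = inj₂ (inj₂ (¬l , ¬r , eq))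
        by-colour false eq = inj₁ (inj₂ (¬l , ¬r , eq))

      differently-coloured : ∀ s {a b Y} → E (graph s) a b Y → I a → I b → c a ≢ c b
      differently-coloured s e ia ib =
        proj₁ (proper (∈-nameList A ia) (∈-nameList A ib)) (edge-DualAtom s e ia ib)

      walk-absurd : ∀ {x s z y} → Approach x s z → Walk z (opposite s) y → ⊥
      walk-absurd r t = no-link (Walk⇒Link (Approach-start r) (proj₂ (append r t)))

      no-Zero-branch : ∀ {Z} → Br A Z → (∀ z → Z z → Zero z) → ⊥
      no-Zero-branch {Z} b all-zero with covers cG (Br⇒BrL-premiss left b)
      ... | a , a′ , Y , e , pa , pa′ = go pa pa′
        where
        st : Step left a a′
        st = Y , inj₁ e , ≐-sym (label∖I≐N left e)
        Z⊆I : ∀ {z} → Z z → I z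
        Z⊆I {z} = Br⊆names A b z
        go : (Z ∪ N) a → (Z ∪ N) a′ → ⊥
        go (inj₂ na) (inj₂ na′) = no-link (Walk⇒Link na (last st na′))
        go (inj₂ na) (inj₁ za′) = Zero⇒¬Reached (all-zero a′ za′) (a , first na st (Z⊆I za′))
        go (inj₁ za) (inj₂ na′) = Zero⇒¬Reached (all-zero a za) (a′ , first na′ (Step-sym st) (Z⊆I za))
        go (inj₁ za) (inj₁ za′) with all-zero a za | all-zero a′ za′
        ... | inj₁ (_ , x , r) | z′ = Zero⇒¬Reached z′ (x , next r st (Z⊆I za′))
        ... | z | inj₁ (_ , x , r) = Zero⇒¬Reached z (x , next r (Step-sym st) (Z⊆I za))
        ... | inj₂ (_ , _ , ca) | inj₂ (_ , _ , ca′) =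
          differently-coloured left e (Z⊆I za) (Z⊆I za′) (trans ca (sym ca′))

      no-One-branch : ∀ {W} → Br (neg A) W → (∀ z → W z → One z) → ⊥
      no-One-branch {W} b all-one with covers cH (Br⇒BrL-premiss right b)
      ... | a , a′ , Y , e , pa , pa′ = go pa pa′
        where
        st : Step right a a′
        st = Y , inj₁ e , ≐-sym (label∖I≐N right e)
        W⊆I : ∀ {z} → W z → I z
        W⊆I {z} w = to (names-neg A) (Br⊆names (neg A) b z w)
        go : (W ∪ N) a → (W ∪ N) a′ → ⊥
        go (inj₂ na) (inj₂ na′) = no-link (Walk⇒Link na (last st na′))
        go (inj₂ na) (inj₁ wa′) with all-one a′ wa′
        ... | inj₁ (_ , r) = walk-absurd r (last (Step-sym st) na)
        ... | inj₂ (_ , ¬r , _) = ¬r (a , first na st (W⊆I wa′))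
        go (inj₁ wa) (inj₂ na′) with all-one a wa
        ... | inj₁ (_ , r) = walk-absurd r (last st na′)
        ... | inj₂ (_ , ¬r , _) = ¬r (a′ , first na′ (Step-sym st) (W⊆I wa))
        go (inj₁ wa) (inj₁ wa′) with all-one a wa | all-one a′ wa′
        ... | inj₁ (_ , r) | inj₁ (_ , r′) = walk-absurd r (step st (W⊆I wa′) (reverse r′))
        ... | inj₁ (x , r) | inj₂ (_ , ¬r , _) = ¬r (x , next r st (W⊆I wa′))
        ... | inj₂ (_ , ¬r , _) | inj₁ (x , r′) = ¬r (x , next r′ (Step-sym st) (W⊆I wa))
        ... | inj₂ (_ , _ , ca) | inj₂ (_ , _ , ca′) =
          differently-coloured right e (W⊆I wa) (W⊆I wa′) (trans ca (sym ca′))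

      absurd : ⊥
      absurd with Br-or-Br-neg A {Zero} {One} Zero-or-One
      ... | inj₁ (_ , b , all-zero) = no-Zero-branch b all-zero
      ... | inj₂ (_ , b , all-one) = no-One-branch b all-one

    -- Only doubly negated: the argument decides reachability and colours the names of A classically.
    ¬¬-Link : ¬ ¬ (Σ ℕ λ x → Σ ℕ λ y → Link x y)
    ¬¬-Link no-link =
      ¬¬-∀∈ (nameList A) decide-sides λ reached? →
      ¬¬-Proper (nameList A) λ (c , proper) →
      Contradiction.absurd (λ l → no-link (_ , _ , l)) reached? c proper
      where
      decide-sides : ∀ z → ¬ ¬ (∀ s → Dec (Reached s z))
      decide-sides z k = ¬¬-excluded-middle λ dl → ¬¬-excluded-middle λ dr → k λ { left → dl ; right → dr }

    V? : ∀ v → Dec (V G v ⊎ V H v)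
    V? v = map′ in-G (λ { (inj₁ p) → to (vertices cG) p ; (inj₂ p) → map₁ (to (names-neg A)) (to (vertices cH) p) })
                (namesL? (A ∷ Γ) v)

    Alt? : ∀ s xs → Dec (Alt (graph s) (graph (opposite s)) I N xs)
    Alt? s [] = yes (lift tt)
    Alt? s (x ∷ []) = yes (lift tt)
    Alt? left (x ∷ y ∷ r) = Step? left x y ×-dec Alt? right (y ∷ r)
    Alt? right (x ∷ y ∷ r) = Step? right x y ×-dec Alt? left (y ∷ r)

    PathThrough : ℕ → ℕ → List ℕ → Set₁
    PathThrough x y ms =
      let xs = x ∷ (ms ++ y ∷ []) in
      Unique xs × All (λ v → V G v ⊎ V H v) xs × All I ms × ¬ I x × ¬ I y × (Alt G H I N xs ⊎ Alt H G I N xs)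

    PathThrough? : ∀ x y ms → Dec (PathThrough x y ms)
    PathThrough? x y ms =
      unique? _ ×-dec All.all? V? _ ×-dec All.all? (names? A) ms ×-dec ¬? (names? A x) ×-dec ¬? (names? A y) ×-dec
      (Alt? left _ ⊎-dec Alt? right _)

    -- The interior of a complete path is a repetition-free list of names of A.
    CompletePath? : ∀ x y → Dec (CompletePath G H I N x y)
    CompletePath? x y = map′ Any.satisfied
      (λ (ms , p@(unique , _ , ms⊆I , _)) → lose (∈-lists≤ _ (nameList A) (names-list ms⊆I)
                                                           (length-Unique-⊆ (inner unique) (names-list ms⊆I))) p)
      (Any.any? (PathThrough? x y) (lists≤ (length (nameList A)) (nameList A)))
      where
      names-list : ∀ {ms} → All I ms → All (_∈ nameList A) ms
      names-list = All.map (∈-nameList A)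
      inner : ∀ {ms} → Unique (x ∷ ms ++ y ∷ []) → Unique ms
      inner {ms} u = Unique-++⁻ˡ ms (AllPairs.tail u)

    Link? : ∀ x y → Dec (Link x y)
    Link? x y = namesL? Γ x ×-dec namesL? Γ y ×-dec ¬? (x ≟ y) ×-dec CompletePath? x y

    -- Realising links by axioms

    path⇒Walk : ∀ s u ms {y} → Alt (graph s) (graph (opposite s)) I N (u ∷ ms ++ y ∷ []) →
      All I ms → N y → Walk u s y
    path⇒Walk s u [] (st , _) [] ny = last st ny
    path⇒Walk left u (w ∷ ms) (st , alt) (i ∷ is) ny = step st i (path⇒Walk right w ms alt is ny)
    path⇒Walk right u (w ∷ ms) (st , alt) (i ∷ is) ny = step st i (path⇒Walk left w ms alt is ny)

    Link-complementary : ∀ {x y α} → Link x y → Occursᴸ Γ x α → Occursᴸ Γ y (bar α)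
    Link-complementary (_ , ny , _ , ms , _ , _ , is , _ , _ , inj₁ alt) o =
      Walk-complementary (path⇒Walk left _ ms alt is ny) (there o)
    Link-complementary (_ , ny , _ , ms , _ , _ , is , _ , _ , inj₂ alt) o =
      Walk-complementary (path⇒Walk right _ ms alt is ny) (there o)

    record Realises (ps : List (ℕ × ℕ)) (R : Deriv Γ) : Set₂ where
      field
        cut-free : CutFree R
        vertices≐ : V ⟪ R ⟫ ≐ N
        edge⇒∈ : ∀ {u v Z} → E ⟪ R ⟫ u v Z → ((u , v) ∈ ps ⊎ (v , u) ∈ ps) × (Z ≐ N)
        ∈⇒edge : ∀ {u v} → (u , v) ∈ ps → Σ Subset λ Z → E ⟪ R ⟫ u v Z × (Z ≐ N)
    open Realises

    atom-name : ∀ {a b x y} → atom a x ≡ atom b y → x ≡ y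
    atom-name refl = refl

    axiom : ∀ {x y} → Link x y → Σ (Deriv Γ) (Realises ((x , y) ∷ []))
    axiom {x} {y} l@(nx , ny , x≢y , _) with namesL-atomic Γ Γ-atomic nx | namesL-atomic Γ Γ-atomic ny
    ... | α , x∈ | β , y∈
        with Occursᴸ-functional Γ WF-Γ (∈⇒Occursᴸ y∈) (Link-complementary l (∈⇒Occursᴸ x∈))
    ... | refl with ∈⇒↭∷ x∈
    ... | Γ₁ , Γ↭ with Any-resp-↭ Γ↭ y∈
    ... | here eq = ⊥-elim (x≢y (sym (atom-name eq)))
    ... | there y∈Γ₁ with ∈⇒↭∷ y∈Γ₁
    ... | Δ , Γ₁↭ = ax Δ (atom α x) (atom α y) refl WF-Γ perm , record
      { cut-free = tt
      ; vertices≐ = names≐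
      ; edge⇒∈ = λ { (_ , _ , (lift ends , lift X≐) , bY , lift Z≐) →
          Data.Sum.map (λ { (refl , refl) → here refl }) (λ { (refl , refl) → here refl }) ends ,
          ≐-trans Z≐ (≐-trans (∪-cong X≐ (BrL-atomic-≐ Δ Δ-atomic bY)) names≐) }
      ; ∈⇒edge = λ { (here refl) →
          _ , (_ , _ , (lift (inj₁ (refl , refl)) , lift ≐-refl) , BrL-atomic Δ Δ-atomic , lift ≐-refl) , names≐ }
      }
      where
      perm : Γ ↭ atom α x ∷ atom (bar α) y ∷ Δ
      perm = ↭-trans Γ↭ (prep _ Γ₁↭)
      Δ-atomic : All IsAtomic Δ
      Δ-atomic = All.tail (All.tail (All-resp-↭ perm Γ-atomic))
      names≐ : (⟦ x ، y ⟧ ∪ namesL Δ) ≐ N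
      names≐ = ≐-trans (∪-assoc ⟦ x ⟧ ⟦ y ⟧ (namesL Δ)) (≐-sym (namesL-resp-↭ perm))

    superpose : ∀ {ps qs R R′} → Realises ps R → Realises qs R′ → Realises (ps ++ qs) (sup Γ R R′ WF-Γ ↭-refl)
    superpose {ps} r r′ = record
      { cut-free = cut-free r , cut-free r′
      ; vertices≐ = λ z → [ to (vertices≐ r) , to (vertices≐ r′) ]′ , (λ n → inj₁ (from (vertices≐ r) n))
      ; edge⇒∈ = λ { (inj₁ e) → Data.Product.map₁ (Data.Sum.map Anyₚ.++⁺ˡ Anyₚ.++⁺ˡ) (edge⇒∈ r e)
                   ; (inj₂ e) → Data.Product.map₁ (Data.Sum.map (Anyₚ.++⁺ʳ ps) (Anyₚ.++⁺ʳ ps)) (edge⇒∈ r′ e) }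
      ; ∈⇒edge = λ m → [ (λ m → let (Z , e , Z≐) = ∈⇒edge r m in Z , inj₁ e , Z≐) ,
                          (λ m → let (Z , e , Z≐) = ∈⇒edge r′ m in Z , inj₂ e , Z≐) ]′ (Anyₚ.++⁻ ps m)
      }

    realise : ∀ p ps → All (λ (x , y) → Link x y) (p ∷ ps) → Σ (Deriv Γ) (Realises (p ∷ ps))
    realise p [] (l ∷ []) = axiom l
    realise p (q ∷ ps) (l ∷ ls) =
      let (R , r) = axiom l ; (R′ , r′) = realise q ps ls in sup Γ R R′ WF-Γ ↭-refl , superpose r r′

    N⇒composite : ∀ {v} → N v → (V G v ⊎ V H v) × ¬ I v
    N⇒composite n = in-G (inj₂ n) , N∩I-empty n

    composite⇒N : ∀ {v} → (V G v ⊎ V H v) × ¬ I v → N v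
    composite⇒N (inj₁ p , ∉I) = [ (λ i → ⊥-elim (∉I i)) , (λ n → n) ]′ (to (vertices cG) p)
    composite⇒N (inj₂ p , ∉I) = [ (λ i → ⊥-elim (∉I (to (names-neg A) i))) , (λ n → n) ]′ (to (vertices cH) p)

    Alt-relabel : ∀ {G′ H′ X X′} xs → X ≐ X′ → Alt G′ H′ I X xs → Alt G′ H′ I X′ xs
    Alt-relabel [] _ a = a
    Alt-relabel (_ ∷ []) _ a = a
    Alt-relabel (_ ∷ y ∷ r) e ((Y , ed , X≐) , a) = (Y , ed , ≐-trans (≐-sym e) X≐) , Alt-relabel (y ∷ r) e a

    CompletePath-relabel : ∀ {x y X X′} → X ≐ X′ → CompletePath G H I X x y → CompletePath G H I X′ x y
    CompletePath-relabel {x} {y} e (ms , u , vs , is , x∉ , y∉ , alt) =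
      ms , u , vs , is , x∉ , y∉ ,
      Data.Sum.map (Alt-relabel (x ∷ ms ++ y ∷ []) e) (Alt-relabel (x ∷ ms ++ y ∷ []) e) alt

    Alt-label : ∀ s {a b X} ms → Alt (graph s) (graph (opposite s)) I X (a ∷ ms ++ b ∷ []) → X ≐ N
    Alt-label s ms alt with first-step ms alt
      where
      first-step : ∀ {G′ H′ X a b} ms → Alt G′ H′ I X (a ∷ ms ++ b ∷ []) → Σ ℕ λ m → EdI G′ I a m X
      first-step [] (st , _) = _ , st
      first-step (m ∷ _) (st , _) = m , st
    ... | _ , Y , e , X≐ = ≐-trans X≐ ([ label∖I≐N s , label∖I≐N s ]′ e)

    CompletePath-label : ∀ {x y X} → CompletePath G H I X x y → X ≐ N
    CompletePath-label (ms , _ , _ , _ , _ , _ , inj₁ alt) = Alt-label left ms alt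
    CompletePath-label (ms , _ , _ , _ , _ , _ , inj₂ alt) = Alt-label right ms alt

    Link⇒composite-edge : ∀ {x y X} → Link x y → X ≐ N → E (G ⊙[ I ] H) x y X
    Link⇒composite-edge (nx , ny , x≢y , path) X≐ =
      x≢y , N⇒composite nx , N⇒composite ny , (λ z p → N⇒composite (to X≐ p)) ,
      CompletePath-relabel (≐-sym X≐) path

    composite-edge⇒Link : ∀ {x y X} → E (G ⊙[ I ] H) x y X → Link x y × (X ≐ N)
    composite-edge⇒Link (x≢y , vx , vy , _ , path) =
      (composite⇒N vx , composite⇒N vy , x≢y , CompletePath-relabel (CompletePath-label path) path) ,
      CompletePath-label path

    Realises⇒≈G : ∀ {ps R} → All (λ (x , y) → Link x y) ps → (∀ {x y} → Link x y → (x , y) ∈ ps) →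
      Realises ps R → ⟪ R ⟫ ≈G (G ⊙[ I ] H)
    Realises⇒≈G ls complete r = record
      { V≐ = λ z → (λ p → N⇒composite (to (vertices≐ r) p)) , (λ p → from (vertices≐ r) (composite⇒N p))
      ; E⊆ = λ a b X e → let (m , X≐) = edge⇒∈ r e in
          X , ≐-refl , Data.Sum.map (λ m → Link⇒composite-edge (All.lookup ls m) X≐)
                                    (λ m → Link⇒composite-edge (All.lookup ls m) X≐) m
      ; E⊇ = λ a b X e → let (l , X≐) = composite-edge⇒Link e ; (Z , e′ , Z≐) = ∈⇒edge r (complete l) in
          Z , ≐-trans X≐ (≐-sym Z≐) , inj₁ e′
      }

    pairs : List (ℕ × ℕ)
    pairs = cartesianProduct (nameListL Γ) (nameListL Γ)

    links : List (ℕ × ℕ)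
    links = filter (λ (x , y) → Link? x y) pairs

    ∈-links : ∀ {x y} → Link x y → (x , y) ∈ links
    ∈-links l@(nx , ny , _) =
      ∈-filter⁺ (λ (x , y) → Link? x y) (∈-cartesianProduct⁺ (∈-nameListL Γ nx) (∈-nameListL Γ ny)) l

    cut-free-composite : Σ (Deriv Γ) λ R → CutFree R × (⟪ R ⟫ ≈G (G ⊙[ I ] H))
    cut-free-composite = from-list links (Allₚ.all-filter (λ (x , y) → Link? x y) pairs) ∈-links
      where
      from-list : ∀ ps → All (λ (x , y) → Link x y) ps → (∀ {x y} → Link x y → (x , y) ∈ ps) →
        Σ (Deriv Γ) λ R → CutFree R × (⟪ R ⟫ ≈G (G ⊙[ I ] H))
      from-list [] _ complete = ⊥-elim (¬¬-Link λ (_ , _ , l) → case complete l of λ ())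
      from-list (p ∷ ps) ls complete =
        let (R , r) = realise p ps ls in R , cut-free r , Realises⇒≈G ls complete r


lemma15 : (At : Set) (bar : At → At) →
    (∀ a → bar (bar a) ≡ a) → (∀ a → bar a ≢ a) →
    let open WithAtoms At bar in
    (Γ : List Fm) (A : Fm) (P : Deriv (A ∷ Γ)) (Q : Deriv (neg A ∷ Γ)) →
    All IsAtomic Γ → CutFree P → CutFree Q →
    Σ (Deriv Γ) λ R → CutFree R × (⟪ R ⟫ ≈G (⟪ P ⟫ ⊙[ names A ] ⟪ Q ⟫))
lemma15 At bar bar-involutive bar-irreflexive Γ A P Q Γ-atomic cfP cfQ =
  Cut.cut-free-composite Γ A Γ-atomic (Deriv-WF P) (Deriv-WF Q) (⟪⟫-correct P cfP) (⟪⟫-correct Q cfQ)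
  where
  open CutAgainstAtomicContext At bar bar-involutive bar-irreflexive
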